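{- Let $q=p^\nu$ with $p$ prime and $\nu\ge 1$, and let $C^{(p)}$ be the $\mathbb{Z}_p$-scheme constructed as follows. Realize $GF(q)=GF(p)[t]/(f(t))$ for an irreducible $f$ of degree $\nu$; let $S$ be the additive subgroup of classes of polynomials $\sum_{i=1}^{\nu-1}a_it^i$, labelled $\pi_1=0,\pi_2,\dots,\pi_N$ with $N=p^{\nu-1}$; every element of $GF(q)$ is uniquely $\pi+z$ with $\pi\in S$ and $z\in GF(p)$, identified with $\mathbb{Z}_p$. For $\pi\in S$ let $Q_\pi$ be the $N\times N$ $(0,1)$-matrix with entry $1$ at $(r,s)$ iff $\pi_r-\pi_s=\pi$, and for $x=\pi+z$ let $P_x$ be the $\mathbb{Z}_p$-scheme of order $N$ with entry $\{z\}$ where $Q_\pi$ has $1$ and $\emptyset$ where $Q_\pi$ has $0$. Fix a generator $y$ of $GF(q)^\ast$ and define $G=(\gamma_{ij})_{0\le i,j\le q-1}$ by $\gamma_{ij}=y^i/y^j$ for $0\le i,j\le q-2$ and $\gamma_{ij}=0$ if $i=q-1$ or $j=q-1$. Let $C^{(p)}=(\Gamma_{ij})_{0\le i,j\le q-1}$ be the block scheme with $\Gamma_{ij}=P_{\gamma_{ij}}$, a simple $\mathbb{Z}_p$-scheme of order $qN=p^{2\nu-1}$. Then $C^{(p)}$ is $J_2$-free.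
   Context: For $C\subseteq\mathbb{Z}_\mu$, $\overline C$ is the circulant $(0,1)$-matrix of order $\mu$ (indices $0,\dots,\mu-1$) with entry $1$ at $(i,j)$ iff $j-i\pmod\mu\in C$; the blow-up of a scheme $(S_{ij})$ of subsets of $\mathbb{Z}_\mu$ is the block matrix with blocks $\overline{S_{ij}}$. A scheme is $J_2$-free if every $2\times 2$ submatrix (two distinct rows, two distinct columns) of its blow-up contains an entry $0$. -}

module Defs where

open import Data.Nat as ℕ using (ℕ; zero; suc; _^_; _∸_)
open import Data.Integer as ℤ using (ℤ; +_; 0ℤ; 1ℤ; -1ℤ)
open import Data.Integer.Divisibility using (_∣_)
open import Data.Fin using (Fin; toℕ)
open import Data.Vec using (Vec; _∷_; lookup; last; toList)
open import Data.Vec.Relation.Unary.All as VAll using ()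
open import Data.List as L using (List; []; _∷_; map)
open import Data.List.Relation.Unary.All as LAll using ()
open import Data.Product using (Σ; ∃; ∃₂; _×_; _,_; proj₁; proj₂)
open import Data.Sum using (_⊎_)
open import Relation.Nullary using (¬_)
open import Relation.Binary.PropositionalEquality using (_≡_; _≢_)
open import Function.Bundles using (_⤖_; Bijection)

DiffMod : (μ : ℕ) → Fin μ → Fin μ → Fin μ → Set
DiffMod μ a b d = (+ μ) ∣ ((+ toℕ a ℤ.- + toℕ b) ℤ.- + toℕ d)

-- Schemes of subsets of Z_μ, their blow-up, and J₂-freeness.
-- A subset of Z_μ is a predicate on Fin μ; a scheme is indexed by a
-- finite index type I (the rows/columns of the scheme).

SubsetZ : ℕ → Set₁
SubsetZ μ = Fin μ → Set

Scheme : ℕ → Set → Set₁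
Scheme μ I = I → I → SubsetZ μ

-- entry ((i,a),(j,b)) of the blow-up is 1 iff (b - a mod μ) ∈ S i j
BlowUp : {μ : ℕ} {I : Set} → Scheme μ I → (I × Fin μ) → (I × Fin μ) → Set
BlowUp {μ} S (i , a) (j , b) = ∃ λ d → DiffMod μ b a d × S i j d

J2Free : {μ : ℕ} {I : Set} → Scheme μ I → Set
J2Free {μ} {I} S = (R₁ R₂ C₁ C₂ : I × Fin μ) → R₁ ≢ R₂ → C₁ ≢ C₂ →
  ¬ (BlowUp S R₁ C₁ × BlowUp S R₁ C₂ × BlowUp S R₂ C₁ × BlowUp S R₂ C₂)

-- Polynomials with integer coefficients (lowest degree first)

Poly : Set
Poly = List ℤ

infixl 6 _⊕_
infixl 7 _⊛_

_⊕_ : Poly → Poly → Poly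
[] ⊕ q = q
(a ∷ p) ⊕ [] = a ∷ p
(a ∷ p) ⊕ (b ∷ q) = (a ℤ.+ b) ∷ (p ⊕ q)

scale : ℤ → Poly → Poly
scale c = map (c ℤ.*_)

neg : Poly → Poly
neg = scale -1ℤ

_⊛_ : Poly → Poly → Poly
[] ⊛ q = []
(a ∷ p) ⊛ q = scale a q ⊕ (0ℤ ∷ (p ⊛ q))

powP : Poly → ℕ → Poly
powP g zero = 1ℤ ∷ []
powP g (suc k) = g ⊛ powP g k

IsZeroP : Poly → Set
IsZeroP = LAll.All (_≡ 0ℤ)

lift : {p n : ℕ} → Vec (Fin p) n → Poly
lift v = map (λ c → + toℕ c) (toList v)

-- g ≡ h in GF(p)[t]
CongP : ℕ → Poly → Poly → Set
CongP p g h = ∃ λ e → IsZeroP (g ⊕ neg h ⊕ neg (scale (+ p) e))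

-- g ≡ h in GF(p)[t]/(f)
CongPF : ℕ → Poly → Poly → Poly → Set
CongPF p f g h = ∃₂ λ k e → IsZeroP (g ⊕ neg h ⊕ neg (k ⊛ f) ⊕ neg (scale (+ p) e))

-- f (coefficients f₀ … f_ν, f_ν ≠ 0) is irreducible over GF(p):
-- it is not a product of two polynomials of degree ≥ 1 over GF(p)
Irreducible : (p ν : ℕ) → Vec (Fin p) (suc ν) → Set
Irreducible p ν f = (d₁ d₂ : ℕ) (a : Vec (Fin p) (suc (suc d₁))) (b : Vec (Fin p) (suc (suc d₂))) →
  toℕ (last a) ≢ 0 → toℕ (last b) ≢ 0 → ¬ CongP p (lift f) (lift a ⊛ lift b)

-- GF(q) = GF(p)[t]/(f) with q = p^ν: an element is π + z with
-- z ∈ GF(p) = Z_p and π = Σ_{i=1}^{ν-1} a_i t^i ∈ S (coefficient vector).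

SPart : ℕ → ℕ → Set
SPart p ν = Vec (Fin p) (ν ∸ 1)

GF : ℕ → ℕ → Set
GF p ν = Fin p × SPart p ν

toPoly : (p ν : ℕ) → GF p ν → Poly
toPoly p ν (z , π) = lift (z ∷ π)

IsZeroGF : (p ν : ℕ) → GF p ν → Set
IsZeroGF p ν (z , π) = toℕ z ≡ 0 × VAll.All (λ c → toℕ c ≡ 0) π

Generator : (p ν : ℕ) → Vec (Fin p) (suc ν) → GF p ν → Set
Generator p ν f y = ¬ IsZeroGF p ν y ×
  ((x : GF p ν) → ¬ IsZeroGF p ν x → ∃ λ k → CongPF p (lift f) (toPoly p ν x) (powP (toPoly p ν y) k))

-- labelling π₁ = 0, π₂, …, π_N of S with N = p^(ν-1) (indices 0 … N-1)
Labelling : ℕ → ℕ → Set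
Labelling p ν = Fin (p ^ (ν ∸ 1)) ⤖ SPart p ν

label : (p ν : ℕ) → Labelling p ν → Fin (p ^ (ν ∸ 1)) → SPart p ν
label p ν L = Bijection.to L

FirstIsZero : (p ν : ℕ) → Labelling p ν → Set
FirstIsZero p ν L = ∀ k → toℕ k ≡ 0 → VAll.All (λ c → toℕ c ≡ 0) (label p ν L k)

data Gamma (p ν : ℕ) (f : Vec (Fin p) (suc ν)) (y : GF p ν) (i j : Fin (p ^ ν)) (x : GF p ν) : Set where
  lastRow : toℕ i ≡ p ^ ν ∸ 1 → IsZeroGF p ν x → Gamma p ν f y i j x
  lastCol : toℕ j ≡ p ^ ν ∸ 1 → IsZeroGF p ν x → Gamma p ν f y i j x
  inner   : toℕ i ≢ p ^ ν ∸ 1 → toℕ j ≢ p ^ ν ∸ 1 →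
            CongPF p (lift f) (toPoly p ν x ⊛ powP (toPoly p ν y) (toℕ j)) (powP (toPoly p ν y) (toℕ i)) →
            Gamma p ν f y i j x

-- π_r - π_s = π  (coefficientwise in Z_p), i.e. (Q_π)_{rs} = 1
SDiff : (p ν : ℕ) → SPart p ν → SPart p ν → SPart p ν → Set
SDiff p ν πr πs π = ∀ l → DiffMod p (lookup πr l) (lookup πs l) (lookup π l)

-- The scheme C^(p) = (Γ_ij) with Γ_ij = P_{γ_ij}, flattened to a Z_p-scheme
-- indexed by (i , r) ∈ Fin q × Fin N: entry {z} if π_r - π_s = π and ∅
-- otherwise, where γ_ij = π + z.
CScheme : (p ν : ℕ) → Vec (Fin p) (suc ν) → Labelling p ν → GF p ν →
          Scheme p (Fin (p ^ ν) × Fin (p ^ (ν ∸ 1)))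
CScheme p ν f L y (i , r) (j , s) d =
  ∃ λ (x : GF p ν) → Gamma p ν f y i j x × SDiff p ν (label p ν L r) (label p ν L s) (proj₂ x) × proj₁ x ≡ d

module Submission where

-- An entry ((i,r),a | (j,s),b) of the blow-up of C^(p) is 1 exactly when
-- γ_ij = (π_r - a) - (π_s - b) in GF(q).  Since γ_ij = e_i · e'_j with
-- e_i = y^i, e'_j = y^(-j) (and 0 for the last index), four 1's at rows
-- (i,c₁), (i',c₂) and columns (j,d₁), (j',d₂) give
--   (e_i - e_i')(e'_j - e'_j') = γ_ij - γ_ij' - γ_i'j + γ_i'j'
--                              = (c₁-d₁) - (c₁-d₂) - (c₂-d₁) + (c₂-d₂) = 0,
-- so, GF(q) being a field, e_i = e_i' or e'_j = e'_j'.  As y has order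
-- q - 1, this means i = i' (then c₁ = c₂) or j = j' (then d₁ = d₂): the two
-- rows or the two columns coincide.

open import Defs
open import Data.Nat as ℕ using (ℕ; zero; suc; _≤_; _<_; z≤n; s≤s; _^_; _∸_)
import Data.Nat.Properties as ℕP
open import Data.Nat.Divisibility as ℕD using (∣1⇒≡1)
open import Data.Nat.DivMod using (_%_; _/_; m%n<n; m≡m%n+[m/n]*n)
open import Data.Nat.Induction using (<-rec)
open import Data.Nat.Primality using (Prime; euclidsLemma; prime⇒irreducible; prime⇒nonZero; ¬prime[1])
open import Data.Nat.Coprimality using (Coprime; coprime-Bézout)
open import Data.Nat.GCD using (module Bézout)
open import Data.Integer as ℤ using (ℤ; 0ℤ; 1ℤ; -1ℤ; _+_; _*_; -_; _-_; _⊖_; -[1+_])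
import Data.Integer.Properties as ℤP
open import Data.Integer.Divisibility.Signed as ℤD using (divides)
open import Data.Integer.DivMod using (_%ℕ_; _/ℕ_; n%ℕd<d; a≡a%ℕn+[a/ℕn]*n)
open import Data.Integer.Tactic.RingSolver using (solve-∀)
open import Data.Fin as Fin using (Fin; toℕ; fromℕ<)
import Data.Fin.Properties as FinP
open import Data.List using ([]; _∷_; length)
import Data.List.Properties as LP
import Data.List.Relation.Unary.All as LAll
open import Data.Vec as V using (Vec; _∷_; toList; last; init; lookup)
import Data.Vec.Properties as VP
open import Data.Vec.Relation.Unary.All as VAll using ()
open import Data.Maybe using (Maybe; just; nothing)
open import Data.Product using (Σ; ∃; ∃₂; _,_; proj₁; proj₂; _×_; uncurry)
open import Data.Sum as Sum using (_⊎_; inj₁; inj₂; [_,_]′)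
open import Data.Empty using (⊥; ⊥-elim)
open import Function.Bundles using (Bijection)
open import Level using (0ℓ)
open import Algebra.Bundles using (CommutativeRing)
open import Algebra.Structures using (IsCommutativeRing)
open import Relation.Nullary using (¬_; yes; no; Dec)
open import Relation.Nullary.Decidable using (_×-dec_)
open import Relation.Binary.Bundles using (Setoid)
open import Relation.Binary.Structures using (IsEquivalence)
open import Relation.Binary.Definitions using (Tri; tri<; tri≈; tri>)
open import Relation.Binary.PropositionalEquality
import Relation.Binary.Reasoning.Setoid as SetoidReasoning
import Tactic.RingSolver.Core.AlmostCommutativeRing as ACR
open import Tactic.RingSolver using () renaming (solve-∀ to solvePoly)

coeff : Poly → ℕ → ℤ
coeff []      n       = 0ℤ
coeff (a ∷ g) zero    = a
coeff (a ∷ g) (suc n) = coeff g n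

-- Equality of polynomials: equal coefficients (trailing zeros are ignored).
infix 4 _≐_
record _≐_ (g h : Poly) : Set where
  constructor coeffwise
  field ≐-at : ∀ n → coeff g n ≡ coeff h n
open _≐_ public

coeff-⊕ : ∀ g h n → coeff (g ⊕ h) n ≡ coeff g n + coeff h n
coeff-⊕ []      h       n       = sym (ℤP.+-identityˡ _)
coeff-⊕ (a ∷ g) []      n       = sym (ℤP.+-identityʳ _)
coeff-⊕ (a ∷ g) (b ∷ h) zero    = refl
coeff-⊕ (a ∷ g) (b ∷ h) (suc n) = coeff-⊕ g h n

coeff-scale : ∀ c g n → coeff (scale c g) n ≡ c * coeff g n
coeff-scale c []      n       = sym (ℤP.*-zeroʳ c)
coeff-scale c (a ∷ g) zero    = refl
coeff-scale c (a ∷ g) (suc n) = coeff-scale c g n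

coeff-neg : ∀ g n → coeff (neg g) n ≡ - coeff g n
coeff-neg g n = trans (coeff-scale -1ℤ g n) (ℤP.-1*i≡-i (coeff g n))

coeff-⊛ : ∀ a g h n → coeff ((a ∷ g) ⊛ h) n ≡ a * coeff h n + coeff (0ℤ ∷ (g ⊛ h)) n
coeff-⊛ a g h n = trans (coeff-⊕ (scale a h) (0ℤ ∷ (g ⊛ h)) n) (cong (_+ _) (coeff-scale a h n))

coeff-const⊛ : ∀ c g n → coeff ((c ∷ []) ⊛ g) n ≡ c * coeff g n
coeff-const⊛ c g zero    = trans (coeff-⊛ c [] g 0) (ℤP.+-identityʳ _)
coeff-const⊛ c g (suc n) = trans (coeff-⊛ c [] g (suc n)) (ℤP.+-identityʳ _)

shift-cong : ∀ {u v} → (∀ n → coeff u n ≡ coeff v n) → ∀ n → coeff (0ℤ ∷ u) n ≡ coeff (0ℤ ∷ v) n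
shift-cong e zero    = refl
shift-cong e (suc n) = e n

≐-refl : ∀ {g} → g ≐ g
≐-refl = coeffwise λ n → refl

≐-sym : ∀ {g h} → g ≐ h → h ≐ g
≐-sym e = coeffwise λ n → sym (≐-at e n)

≐-trans : ∀ {g h k} → g ≐ h → h ≐ k → g ≐ k
≐-trans e e' = coeffwise λ n → trans (≐-at e n) (≐-at e' n)

⊕-cong : ∀ {g g' h h'} → g ≐ g' → h ≐ h' → g ⊕ h ≐ g' ⊕ h'
⊕-cong {g} {g'} {h} {h'} e e' = coeffwise λ n → begin
  coeff (g ⊕ h) n         ≡⟨ coeff-⊕ g h n ⟩
  coeff g n + coeff h n   ≡⟨ cong₂ _+_ (≐-at e n) (≐-at e' n) ⟩
  coeff g' n + coeff h' n ≡⟨ coeff-⊕ g' h' n ⟨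
  coeff (g' ⊕ h') n       ∎
  where open ≡-Reasoning

neg-cong : ∀ {g g'} → g ≐ g' → neg g ≐ neg g'
neg-cong {g} {g'} e = coeffwise λ n →
  trans (coeff-neg g n) (trans (cong -_ (≐-at e n)) (sym (coeff-neg g' n)))

⊕-assoc : ∀ g h k → (g ⊕ h) ⊕ k ≐ g ⊕ (h ⊕ k)
⊕-assoc g h k = coeffwise λ n → begin
  coeff ((g ⊕ h) ⊕ k) n               ≡⟨ coeff-⊕ (g ⊕ h) k n ⟩
  coeff (g ⊕ h) n + coeff k n         ≡⟨ cong (_+ coeff k n) (coeff-⊕ g h n) ⟩
  coeff g n + coeff h n + coeff k n   ≡⟨ ℤP.+-assoc (coeff g n) _ _ ⟩
  coeff g n + (coeff h n + coeff k n) ≡⟨ cong (coeff g n +_) (coeff-⊕ h k n) ⟨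
  coeff g n + coeff (h ⊕ k) n         ≡⟨ coeff-⊕ g (h ⊕ k) n ⟨
  coeff (g ⊕ (h ⊕ k)) n               ∎
  where open ≡-Reasoning

⊕-comm : ∀ g h → g ⊕ h ≐ h ⊕ g
⊕-comm g h = coeffwise λ n →
  trans (coeff-⊕ g h n) (trans (ℤP.+-comm (coeff g n) _) (sym (coeff-⊕ h g n)))

⊕-identityʳ : ∀ g → g ⊕ [] ≐ g
⊕-identityʳ g = coeffwise λ n → trans (coeff-⊕ g [] n) (ℤP.+-identityʳ _)

neg-inverseˡ : ∀ g → neg g ⊕ g ≐ []
neg-inverseˡ g = coeffwise λ n →
  trans (coeff-⊕ (neg g) g n) (trans (cong (_+ coeff g n) (coeff-neg g n)) (ℤP.+-inverseˡ (coeff g n)))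

⊛-congʳ : ∀ g {h h'} → h ≐ h' → g ⊛ h ≐ g ⊛ h'
⊛-congʳ []      e = ≐-refl
⊛-congʳ (a ∷ g) {h} {h'} e = coeffwise λ n → begin
  coeff ((a ∷ g) ⊛ h) n                          ≡⟨ coeff-⊛ a g h n ⟩
  a * coeff h n + coeff (0ℤ ∷ (g ⊛ h)) n         ≡⟨ cong₂ _+_ (cong (a *_) (≐-at e n)) (shift-cong (≐-at (⊛-congʳ g e)) n) ⟩
  a * coeff h' n + coeff (0ℤ ∷ (g ⊛ h')) n       ≡⟨ coeff-⊛ a g h' n ⟨
  coeff ((a ∷ g) ⊛ h') n                         ∎
  where open ≡-Reasoning

coeff-scale⊛ : ∀ c h k n → coeff (scale c h ⊛ k) n ≡ c * coeff (h ⊛ k) n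
coeff-scale⊛ c []      k n = sym (ℤP.*-zeroʳ c)
coeff-scale⊛ c (b ∷ h) k n = begin
  coeff ((c * b ∷ scale c h) ⊛ k) n                  ≡⟨ coeff-⊛ (c * b) (scale c h) k n ⟩
  c * b * coeff k n + coeff (0ℤ ∷ (scale c h ⊛ k)) n ≡⟨ cong (c * b * coeff k n +_) (shifted n) ⟩
  c * b * coeff k n + c * coeff (0ℤ ∷ (h ⊛ k)) n     ≡⟨ factor c b (coeff k n) _ ⟩
  c * (b * coeff k n + coeff (0ℤ ∷ (h ⊛ k)) n)       ≡⟨ cong (c *_) (coeff-⊛ b h k n) ⟨
  c * coeff ((b ∷ h) ⊛ k) n                          ∎
  where
  open ≡-Reasoning
  factor : ∀ c b x y → c * b * x + c * y ≡ c * (b * x + y)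
  factor = solve-∀
  shifted : ∀ n → coeff (0ℤ ∷ (scale c h ⊛ k)) n ≡ c * coeff (0ℤ ∷ (h ⊛ k)) n
  shifted zero    = sym (ℤP.*-zeroʳ c)
  shifted (suc n) = coeff-scale⊛ c h k n

⊛-distribʳ : ∀ g h k → (g ⊕ h) ⊛ k ≐ (g ⊛ k) ⊕ (h ⊛ k)
⊛-distribʳ g h k = coeffwise λ n → trans (pointwise g h n) (sym (coeff-⊕ (g ⊛ k) (h ⊛ k) n))
  where
  regroup : ∀ a b x y z → (a + b) * x + (y + z) ≡ (a * x + y) + (b * x + z)
  regroup = solve-∀
  pointwise : ∀ g h n → coeff ((g ⊕ h) ⊛ k) n ≡ coeff (g ⊛ k) n + coeff (h ⊛ k) n
  shifted : ∀ g h n → coeff (0ℤ ∷ ((g ⊕ h) ⊛ k)) n ≡ coeff (0ℤ ∷ (g ⊛ k)) n + coeff (0ℤ ∷ (h ⊛ k)) n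
  pointwise []      h       n = sym (ℤP.+-identityˡ _)
  pointwise (a ∷ g) []      n = sym (ℤP.+-identityʳ _)
  pointwise (a ∷ g) (b ∷ h) n = begin
    coeff ((a + b ∷ (g ⊕ h)) ⊛ k) n                                          ≡⟨ coeff-⊛ (a + b) (g ⊕ h) k n ⟩
    (a + b) * coeff k n + coeff (0ℤ ∷ ((g ⊕ h) ⊛ k)) n                        ≡⟨ cong ((a + b) * coeff k n +_) (shifted g h n) ⟩
    (a + b) * coeff k n + (coeff (0ℤ ∷ (g ⊛ k)) n + coeff (0ℤ ∷ (h ⊛ k)) n)  ≡⟨ regroup a b (coeff k n) _ _ ⟩
    (a * coeff k n + coeff (0ℤ ∷ (g ⊛ k)) n) + (b * coeff k n + coeff (0ℤ ∷ (h ⊛ k)) n)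
                                                  ≡⟨ cong₂ _+_ (coeff-⊛ a g k n) (coeff-⊛ b h k n) ⟨
    coeff ((a ∷ g) ⊛ k) n + coeff ((b ∷ h) ⊛ k) n ∎
    where open ≡-Reasoning
  shifted g h zero    = refl
  shifted g h (suc n) = pointwise g h n

coeff-⊛[] : ∀ h n → coeff (h ⊛ []) n ≡ 0ℤ
coeff-⊛[] []      n       = refl
coeff-⊛[] (b ∷ h) zero    = refl
coeff-⊛[] (b ∷ h) (suc n) = coeff-⊛[] h n

⊛-zeroʳ : ∀ g → g ⊛ [] ≐ []
⊛-zeroʳ g = coeffwise (coeff-⊛[] g)

coeff-⊛∷ : ∀ h a g n → coeff (h ⊛ (a ∷ g)) n ≡ a * coeff h n + coeff (0ℤ ∷ (h ⊛ g)) n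
coeff-⊛∷ []      a g zero    = sym (trans (ℤP.+-identityʳ _) (ℤP.*-zeroʳ a))
coeff-⊛∷ []      a g (suc n) = sym (trans (ℤP.+-identityʳ _) (ℤP.*-zeroʳ a))
coeff-⊛∷ (b ∷ h) a g zero    = trans (coeff-⊛ b h (a ∷ g) 0) (cong (_+ 0ℤ) (ℤP.*-comm b a))
coeff-⊛∷ (b ∷ h) a g (suc n) = begin
  coeff ((b ∷ h) ⊛ (a ∷ g)) (suc n)                         ≡⟨ coeff-⊛ b h (a ∷ g) (suc n) ⟩
  b * coeff g n + coeff (h ⊛ (a ∷ g)) n                     ≡⟨ cong (b * coeff g n +_) (coeff-⊛∷ h a g n) ⟩
  b * coeff g n + (a * coeff h n + coeff (0ℤ ∷ (h ⊛ g)) n)  ≡⟨ swap a b (coeff g n) (coeff h n) _ ⟩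
  a * coeff h n + (b * coeff g n + coeff (0ℤ ∷ (h ⊛ g)) n)  ≡⟨ cong (a * coeff h n +_) (coeff-⊛ b h g n) ⟨
  a * coeff h n + coeff ((b ∷ h) ⊛ g) n                     ∎
  where
  open ≡-Reasoning
  swap : ∀ a b x y z → b * x + (a * y + z) ≡ a * y + (b * x + z)
  swap = solve-∀

⊛-comm : ∀ g h → g ⊛ h ≐ h ⊛ g
⊛-comm g h = coeffwise (pointwise g h)
  where
  pointwise : ∀ g h n → coeff (g ⊛ h) n ≡ coeff (h ⊛ g) n
  pointwise []      h n = sym (coeff-⊛[] h n)
  pointwise (a ∷ g) h n = trans (coeff-⊛ a g h n)
    (trans (cong (a * coeff h n +_) (shift-cong (pointwise g h) n)) (sym (coeff-⊛∷ h a g n)))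

⊛-assoc : ∀ g h k → (g ⊛ h) ⊛ k ≐ g ⊛ (h ⊛ k)
⊛-assoc g h k = coeffwise (pointwise g)
  where
  dropZero : ∀ a x y z → a * x + (0ℤ * y + z) ≡ a * x + z
  dropZero = solve-∀
  pointwise : ∀ g n → coeff ((g ⊛ h) ⊛ k) n ≡ coeff (g ⊛ (h ⊛ k)) n
  pointwise []      n = refl
  pointwise (a ∷ g) n = begin
    coeff ((scale a h ⊕ (0ℤ ∷ (g ⊛ h))) ⊛ k) n
      ≡⟨ ≐-at (⊛-distribʳ (scale a h) (0ℤ ∷ (g ⊛ h)) k) n ⟩
    coeff ((scale a h ⊛ k) ⊕ ((0ℤ ∷ (g ⊛ h)) ⊛ k)) n
      ≡⟨ coeff-⊕ (scale a h ⊛ k) _ n ⟩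
    coeff (scale a h ⊛ k) n + coeff ((0ℤ ∷ (g ⊛ h)) ⊛ k) n
      ≡⟨ cong₂ _+_ (coeff-scale⊛ a h k n) (coeff-⊛ 0ℤ (g ⊛ h) k n) ⟩
    a * coeff (h ⊛ k) n + (0ℤ * coeff k n + coeff (0ℤ ∷ ((g ⊛ h) ⊛ k)) n)
      ≡⟨ dropZero a (coeff (h ⊛ k) n) (coeff k n) _ ⟩
    a * coeff (h ⊛ k) n + coeff (0ℤ ∷ ((g ⊛ h) ⊛ k)) n
      ≡⟨ cong (a * coeff (h ⊛ k) n +_) (shift-cong (pointwise g) n) ⟩
    a * coeff (h ⊛ k) n + coeff (0ℤ ∷ (g ⊛ (h ⊛ k))) n
      ≡⟨ coeff-⊛ a g (h ⊛ k) n ⟨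
    coeff ((a ∷ g) ⊛ (h ⊛ k)) n ∎
    where open ≡-Reasoning

⊛-cong : ∀ {g g' h h'} → g ≐ g' → h ≐ h' → g ⊛ h ≐ g' ⊛ h'
⊛-cong {g} {g'} {h} {h'} e e' =
  ≐-trans (⊛-congʳ g e') (≐-trans (⊛-comm g h') (≐-trans (⊛-congʳ h' e) (⊛-comm h' g')))

one : Poly
one = 1ℤ ∷ []

⊛-identityˡ : ∀ g → one ⊛ g ≐ g
⊛-identityˡ g = coeffwise λ n → trans (coeff-const⊛ 1ℤ g n) (ℤP.*-identityˡ _)

⊛-identityʳ : ∀ g → g ⊛ one ≐ g
⊛-identityʳ g = ≐-trans (⊛-comm g one) (⊛-identityˡ g)

polyIsCommutativeRing : IsCommutativeRing _≐_ _⊕_ _⊛_ neg [] one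
polyIsCommutativeRing = record
  { isRing = record
    { +-isAbelianGroup = record
      { isGroup = record
        { isMonoid = record
          { isSemigroup = record
            { isMagma = record
              { isEquivalence = record { refl = ≐-refl ; sym = ≐-sym ; trans = ≐-trans }
              ; ∙-cong = ⊕-cong }
            ; assoc = ⊕-assoc }
          ; identity = (λ g → ≐-refl) , ⊕-identityʳ }
        ; inverse = neg-inverseˡ , (λ g → ≐-trans (⊕-comm g (neg g)) (neg-inverseˡ g))
        ; ⁻¹-cong = neg-cong }
      ; comm = ⊕-comm }
    ; *-cong = ⊛-cong
    ; *-assoc = ⊛-assoc
    ; *-identity = ⊛-identityˡ , ⊛-identityʳ
    ; distrib = distribˡ , (λ k g h → ⊛-distribʳ g h k) }
  ; *-comm = ⊛-comm }
  where
  distribˡ : ∀ k g h → k ⊛ (g ⊕ h) ≐ (k ⊛ g) ⊕ (k ⊛ h)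
  distribˡ k g h = ≐-trans (⊛-comm k (g ⊕ h))
    (≐-trans (⊛-distribʳ g h k) (⊕-cong (⊛-comm g k) (⊛-comm h k)))

PolyRing : CommutativeRing 0ℓ 0ℓ
PolyRing = record { isCommutativeRing = polyIsCommutativeRing }

-- Polynomial identities in ℤ[t] are proved by the ring solver over this
-- structure; the zero test only needs to be sound.
PolySolverRing : ACR.AlmostCommutativeRing 0ℓ 0ℓ
PolySolverRing = ACR.fromCommutativeRing PolyRing isZero
  where
  isZero : (g : Poly) → Maybe ([] ≐ g)
  isZero [] = just ≐-refl
  isZero (ℤ.+ zero ∷ g) with isZero g
  ... | nothing = nothing
  ... | just e  = just (coeffwise λ { zero → refl ; (suc n) → ≐-at e n })
  isZero (_ ∷ g) = nothing

infix 4 _∣ℤ_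
_∣ℤ_ : ℕ → ℤ → Set
p ∣ℤ c = ℤ.+ p ℤD.∣ c

prime∣product : ∀ {p} a b → Prime p → p ∣ℤ a * b → p ∣ℤ a ⊎ p ∣ℤ b
prime∣product {p} a b pp p∣ab
  with euclidsLemma ℤ.∣ a ∣ ℤ.∣ b ∣ pp (subst (p ℕD.∣_) (ℤP.abs-* a b) (ℤD.∣⇒∣ᵤ p∣ab))
... | inj₁ p∣a = inj₁ (ℤD.∣ᵤ⇒∣ p∣a)
... | inj₂ p∣b = inj₂ (ℤD.∣ᵤ⇒∣ p∣b)

prime-coprime : ∀ {p n} → Prime p → ¬ (p ℕD.∣ n) → Coprime p n
prime-coprime pp p∤n (i∣p , i∣n) with prime⇒irreducible pp i∣p
... | inj₁ i≡1 = i≡1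
... | inj₂ refl = ⊥-elim (p∤n i∣n)

natInverse : ∀ {p} n → Prime p → ¬ (p ℕD.∣ n) → Σ ℤ λ u → p ∣ℤ ℤ.+ n * u - 1ℤ
natInverse {p} n pp p∤n with coprime-Bézout (prime-coprime pp p∤n)
... | Bézout.+- x y eq = - ℤ.+ y , divides (- ℤ.+ x) (begin
  ℤ.+ n * - ℤ.+ y - 1ℤ         ≡⟨ negate (ℤ.+ n) (ℤ.+ y) ⟩
  - (1ℤ + ℤ.+ y * ℤ.+ n)       ≡⟨ cong (λ m → - (1ℤ + m)) (sym (ℤP.pos-* y n)) ⟩
  - ℤ.+ (1 ℕ.+ y ℕ.* n)        ≡⟨ cong (λ m → - ℤ.+ m) eq ⟩
  - ℤ.+ (x ℕ.* p)              ≡⟨ cong -_ (ℤP.pos-* x p) ⟩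
  - (ℤ.+ x * ℤ.+ p)            ≡⟨ ℤP.neg-distribˡ-* (ℤ.+ x) (ℤ.+ p) ⟩
  - ℤ.+ x * ℤ.+ p              ∎)
  where
  open ≡-Reasoning
  negate : ∀ n y → n * - y - 1ℤ ≡ - (1ℤ + y * n)
  negate = solve-∀
... | Bézout.-+ x y eq = ℤ.+ y , divides (ℤ.+ x) (begin
  ℤ.+ n * ℤ.+ y - 1ℤ           ≡⟨ cong (_- 1ℤ) (sym (ℤP.pos-* n y)) ⟩
  ℤ.+ (n ℕ.* y) - 1ℤ           ≡⟨ cong (λ m → ℤ.+ m - 1ℤ) (trans (ℕP.*-comm n y) (sym eq)) ⟩
  ℤ.+ (1 ℕ.+ x ℕ.* p) - 1ℤ     ≡⟨ cancel (ℤ.+ (x ℕ.* p)) ⟩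
  ℤ.+ (x ℕ.* p)                ≡⟨ ℤP.pos-* x p ⟩
  ℤ.+ x * ℤ.+ p                ∎)
  where
  open ≡-Reasoning
  cancel : ∀ m → (1ℤ + m) - 1ℤ ≡ m
  cancel = solve-∀

intInverse : ∀ {p} c → Prime p → ¬ (p ∣ℤ c) → Σ ℤ λ c' → p ∣ℤ c * c' - 1ℤ
intInverse (ℤ.+ n) pp p∤c = natInverse n pp (λ p∣n → p∤c (ℤD.∣ᵤ⇒∣ p∣n))
intInverse -[1+ n ] pp p∤c with natInverse (suc n) pp (λ p∣n → p∤c (ℤD.∣ᵤ⇒∣ p∣n))
... | u , p∣nu-1 = - u , subst (λ m → _ ∣ℤ m - 1ℤ) (negSquare (ℤ.+ suc n) u) p∣nu-1
  where
  negSquare : ∀ a u → a * u ≡ (- a) * (- u)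
  negSquare = solve-∀

below-divisor : ∀ {p d} → d ℕ.< p → p ℕD.∣ d → d ≡ 0
below-divisor {d = zero}  d<p p∣d = refl
below-divisor {d = suc d} d<p p∣d = ⊥-elim (ℕD.>⇒∤ d<p p∣d)

-- If v ≤ u < p then 0 ≤ u - v < p, so p ∣ u - v forces u ≤ v.
congruent-ordered : ∀ {p} u v → u ℕ.< p → v ℕ.≤ u → p ℕD.∣ ℤ.∣ u ⊖ v ∣ → u ℕ.≤ v
congruent-ordered {p} u v u<p v≤u p∣u-v = ℕP.m∸n≡0⇒m≤n (below-divisor (ℕP.≤-<-trans (ℕP.m∸n≤m u v) u<p)
  (subst (p ℕD.∣_) (cong ℤ.∣_∣ (ℤP.⊖-≥ v≤u)) p∣u-v))

congruent-below : ∀ {p} u v → u ℕ.< p → v ℕ.< p → p ℕD.∣ ℤ.∣ u ⊖ v ∣ → u ≡ v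
congruent-below {p} u v u<p v<p p∣u-v with ℕP.≤-total v u
... | inj₁ v≤u = ℕP.≤-antisym (congruent-ordered u v u<p v≤u p∣u-v) v≤u
... | inj₂ u≤v = ℕP.≤-antisym u≤v
  (congruent-ordered v u v<p u≤v (subst (p ℕD.∣_) (ℤP.∣m⊖n∣≡∣n⊖m∣ u v) p∣u-v))

ι : ∀ {p} → Fin p → ℤ
ι c = ℤ.+ toℕ c

residue-injective : ∀ {p} (u v : Fin p) → p ∣ℤ ι u - ι v → u ≡ v
residue-injective {p} u v p∣u-v = FinP.toℕ-injective (congruent-below _ _ (FinP.toℕ<n u) (FinP.toℕ<n v)
  (subst (λ m → p ℕD.∣ ℤ.∣ m ∣) (ℤP.[+m]-[+n]≡m⊖n (toℕ u) (toℕ v)) (ℤD.∣⇒∣ᵤ p∣u-v)))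

residue-zero : ∀ {p} (c : Fin p) → p ∣ℤ ι c → toℕ c ≡ 0
residue-zero c p∣c = below-divisor (FinP.toℕ<n c) (ℤD.∣⇒∣ᵤ p∣c)

residueOf : ∀ p .{{_ : ℕ.NonZero p}} → ℤ → Fin p
residueOf p c = fromℕ< (n%ℕd<d c p)

residueOf-congruent : ∀ p .{{_ : ℕ.NonZero p}} c → p ∣ℤ ι (residueOf p c) - c
residueOf-congruent p c = divides (- (c /ℕ p)) (begin
  ι (residueOf p c) - c                        ≡⟨ cong (λ r → ℤ.+ r - c) (FinP.toℕ-fromℕ< (n%ℕd<d c p)) ⟩
  ℤ.+ (c %ℕ p) - c                             ≡⟨ cong (λ c′ → ℤ.+ (c %ℕ p) - c′) (a≡a%ℕn+[a/ℕn]*n c p) ⟩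
  ℤ.+ (c %ℕ p) - (ℤ.+ (c %ℕ p) + c /ℕ p * ℤ.+ p) ≡⟨ cancel (ℤ.+ (c %ℕ p)) (c /ℕ p) (ℤ.+ p) ⟩
  - (c /ℕ p) * ℤ.+ p                           ∎)
  where
  open ≡-Reasoning
  cancel : ∀ r q p → r - (r + q * p) ≡ (- q) * p
  cancel = solve-∀

residueOf-nonzero : ∀ p .{{_ : ℕ.NonZero p}} c → ¬ (p ∣ℤ c) → toℕ (residueOf p c) ≢ 0
residueOf-nonzero p c p∤c r≡0 = p∤c (subst (p ∣ℤ_) (ℤP.neg-involutive c) (ℤD.∣m⇒∣-m p∣-c))
  where
  p∣-c : p ∣ℤ - c
  p∣-c = subst (p ∣ℤ_) (trans (cong (λ r → ℤ.+ r - c) r≡0) (ℤP.+-identityˡ (- c))) (residueOf-congruent p c)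

-- Congruence modulo an ideal I of ℤ[t]: g ~ h iff g - h ∈ I.  It is an
-- equivalence compatible with the ring operations; both reductions used
-- below (modulo p, and modulo (p, f)) are instances.
module IdealCongruence
  (I : Poly → Set)
  (I-resp : ∀ {g h} → g ≐ h → I g → I h)
  (I-zero : I [])
  (I-add : ∀ {g h} → I g → I h → I (g ⊕ h))
  (I-mul : ∀ k {g} → I g → I (k ⊛ g)) where

  infix 4 _~_
  record _~_ (g h : Poly) : Set where
    constructor difference
    field difference-in-ideal : I (g ⊕ neg h)
  open _~_ public

  private
    selfDifference : ∀ g → [] ≐ g ⊕ neg g
    selfDifference = solvePoly PolySolverRing
    reversedDifference : ∀ g h → neg one ⊛ (g ⊕ neg h) ≐ h ⊕ neg g
    reversedDifference = solvePoly PolySolverRing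
    chainedDifference : ∀ g h k → (g ⊕ neg h) ⊕ (h ⊕ neg k) ≐ g ⊕ neg k
    chainedDifference = solvePoly PolySolverRing
    sumDifference : ∀ g g' h h' → (g ⊕ neg g') ⊕ (h ⊕ neg h') ≐ (g ⊕ h) ⊕ neg (g' ⊕ h')
    sumDifference = solvePoly PolySolverRing
    productDifference : ∀ g g' h h' → (h ⊛ (g ⊕ neg g')) ⊕ (g' ⊛ (h ⊕ neg h')) ≐ (g ⊛ h) ⊕ neg (g' ⊛ h')
    productDifference = solvePoly PolySolverRing
    negatedDifference : ∀ g h → neg one ⊛ (g ⊕ neg h) ≐ neg g ⊕ neg (neg h)
    negatedDifference = solvePoly PolySolverRing
    regroupDifference : ∀ g g' h → (g ⊕ neg h) ⊕ neg (g' ⊕ neg h) ≐ g ⊕ neg g'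
    regroupDifference = solvePoly PolySolverRing
    regroupDifference′ : ∀ g h h' → (g ⊕ neg h) ⊕ neg (g ⊕ neg h') ≐ h' ⊕ neg h
    regroupDifference′ = solvePoly PolySolverRing

  ≐⇒~ : ∀ {g h} → g ≐ h → g ~ h
  ≐⇒~ {g} {h} e = difference (I-resp (≐-trans (selfDifference h) (⊕-cong (≐-sym e) ≐-refl)) I-zero)

  ~-refl : ∀ {g} → g ~ g
  ~-refl = ≐⇒~ ≐-refl

  ~-sym : ∀ {g h} → g ~ h → h ~ g
  ~-sym {g} {h} (difference d) = difference (I-resp (reversedDifference g h) (I-mul (neg one) d))

  ~-trans : ∀ {g h k} → g ~ h → h ~ k → g ~ k
  ~-trans {g} {h} {k} (difference d) (difference d') = difference (I-resp (chainedDifference g h k) (I-add d d'))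

  ⊕~ : ∀ {g g' h h'} → g ~ g' → h ~ h' → g ⊕ h ~ g' ⊕ h'
  ⊕~ {g} {g'} {h} {h'} (difference d) (difference d') =
    difference (I-resp (sumDifference g g' h h') (I-add d d'))

  ⊛~ : ∀ {g g' h h'} → g ~ g' → h ~ h' → g ⊛ h ~ g' ⊛ h'
  ⊛~ {g} {g'} {h} {h'} (difference d) (difference d') =
    difference (I-resp (productDifference g g' h h') (I-add (I-mul h d) (I-mul g' d')))

  difference-cancelʳ : ∀ {g g' h} → g ⊕ neg h ~ g' ⊕ neg h → g ~ g'
  difference-cancelʳ {g} {g'} {h} (difference d) = difference (I-resp (regroupDifference g g' h) d)

  difference-cancelˡ : ∀ {g h h'} → g ⊕ neg h ~ g ⊕ neg h' → h ~ h'
  difference-cancelˡ {g} {h} {h'} e = ~-sym (difference (I-resp (regroupDifference′ g h h') (difference-in-ideal e)))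

  difference-zero : ∀ {g h} → g ⊕ neg h ~ [] → g ~ h
  difference-zero {g} {h} (difference d) = difference (I-resp (⊕-identityʳ (g ⊕ neg h)) d)

  neg~ : ∀ {g h} → g ~ h → neg g ~ neg h
  neg~ {g} {h} (difference d) = difference (I-resp (negatedDifference g h) (I-mul (neg one) d))

  ~-isEquivalence : IsEquivalence _~_
  ~-isEquivalence = record { refl = ~-refl ; sym = ~-sym ; trans = ~-trans }

  ~-setoid : Setoid 0ℓ 0ℓ
  ~-setoid = record { isEquivalence = ~-isEquivalence }

coeff-beyond : ∀ g n → length g ≤ n → coeff g n ≡ 0ℤ
coeff-beyond []      n       _         = refl
coeff-beyond (a ∷ g) (suc n) (s≤s le) = coeff-beyond g n le

coeff-last : ∀ m (w : Vec ℤ (suc m)) → coeff (toList w) m ≡ last w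
coeff-last zero    (x ∷ V.[]) = refl
coeff-last (suc m) (x ∷ w)    = coeff-last m w

coeff-⊛-beyond : ∀ g h n → length g ℕ.+ length h ≤ suc n → coeff (g ⊛ h) n ≡ 0ℤ
coeff-⊛-beyond []      h n le = refl
coeff-⊛-beyond (a ∷ g) h n le = begin
  coeff ((a ∷ g) ⊛ h) n                  ≡⟨ coeff-⊛ a g h n ⟩
  a * coeff h n + coeff (0ℤ ∷ (g ⊛ h)) n ≡⟨ cong₂ _+_ (cong (a *_) h-vanishes) (shifted n le) ⟩
  a * 0ℤ + 0ℤ                            ≡⟨ trans (ℤP.+-identityʳ _) (ℤP.*-zeroʳ a) ⟩
  0ℤ                                     ∎
  where
  open ≡-Reasoning
  h-vanishes : coeff h n ≡ 0ℤ
  h-vanishes = coeff-beyond h n (ℕP.≤-trans (ℕP.m≤n+m (length h) (length g)) (ℕP.≤-pred le))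
  shifted : ∀ n → suc (length g ℕ.+ length h) ≤ suc n → coeff (0ℤ ∷ (g ⊛ h)) n ≡ 0ℤ
  shifted zero    le = refl
  shifted (suc n) le = coeff-⊛-beyond g h n (ℕP.≤-pred le)

coeff-⊛-top : ∀ e m (u : Vec ℤ (suc e)) (w : Vec ℤ (suc m)) →
  coeff (toList u ⊛ toList w) (e ℕ.+ m) ≡ last u * last w
coeff-⊛-top zero m (c ∷ V.[]) w =
  trans (coeff-const⊛ c (toList w) m) (cong (c *_) (coeff-last m w))
coeff-⊛-top (suc e) m (c ∷ u) w = begin
  coeff ((c ∷ toList u) ⊛ toList w) (suc (e ℕ.+ m))
    ≡⟨ coeff-⊛ c (toList u) (toList w) (suc (e ℕ.+ m)) ⟩
  c * coeff (toList w) (suc (e ℕ.+ m)) + coeff (toList u ⊛ toList w) (e ℕ.+ m)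
    ≡⟨ cong₂ _+_ (cong (c *_) w-vanishes) (coeff-⊛-top e m u w) ⟩
  c * 0ℤ + last u * last w
    ≡⟨ cong (_+ last u * last w) (ℤP.*-zeroʳ c) ⟩
  0ℤ + last u * last w
    ≡⟨ ℤP.+-identityˡ _ ⟩
  last u * last w ∎
  where
  open ≡-Reasoning
  w-vanishes : coeff (toList w) (suc (e ℕ.+ m)) ≡ 0ℤ
  w-vanishes = coeff-beyond (toList w) _ (subst (_≤ suc (e ℕ.+ m)) (sym (VP.length-toList w)) (s≤s (ℕP.m≤n+m m e)))

coeff-difference : ∀ g h n → coeff (g ⊕ neg h) n ≡ coeff g n - coeff h n
coeff-difference g h n = trans (coeff-⊕ g (neg h) n) (cong (coeff g n +_) (coeff-neg h n))

IsZeroP⇒≐[] : ∀ {g} → IsZeroP g → g ≐ []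
IsZeroP⇒≐[] LAll.[]           = ≐-refl
IsZeroP⇒≐[] (a≡0 LAll.∷ rest) = coeffwise λ { zero → a≡0 ; (suc n) → ≐-at (IsZeroP⇒≐[] rest) n }

≐[]⇒IsZeroP : ∀ g → g ≐ [] → IsZeroP g
≐[]⇒IsZeroP []      e = LAll.[]
≐[]⇒IsZeroP (a ∷ g) e = ≐-at e 0 LAll.∷ ≐[]⇒IsZeroP g (coeffwise λ n → ≐-at e (suc n))

module ModP (p : ℕ) where

  DivisibleByP : Poly → Set
  DivisibleByP g = ∀ n → p ∣ℤ coeff g n

  divisible-zero : DivisibleByP []
  divisible-zero n = divides 0ℤ (sym (ℤP.*-zeroˡ (ℤ.+ p)))

  divisible-resp : ∀ {g h} → g ≐ h → DivisibleByP g → DivisibleByP h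
  divisible-resp e d n = subst (p ∣ℤ_) (≐-at e n) (d n)

  divisible-add : ∀ {g h} → DivisibleByP g → DivisibleByP h → DivisibleByP (g ⊕ h)
  divisible-add {g} {h} d d' n = subst (p ∣ℤ_) (sym (coeff-⊕ g h n)) (ℤD.∣m∣n⇒∣m+n (d n) (d' n))

  divisible-mul : ∀ k {g} → DivisibleByP g → DivisibleByP (k ⊛ g)
  divisible-mul []      d n = divisible-zero n
  divisible-mul (a ∷ k) {g} d n =
    subst (p ∣ℤ_) (sym (coeff-⊛ a k g n)) (ℤD.∣m∣n⇒∣m+n (ℤD.∣n⇒∣m*n a (d n)) (shifted n))
    where
    shifted : ∀ n → p ∣ℤ coeff (0ℤ ∷ (k ⊛ g)) n
    shifted zero    = divisible-zero 0
    shifted (suc n) = divisible-mul k d n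

  open IdealCongruence DivisibleByP divisible-resp divisible-zero (λ {g} {h} → divisible-add {g} {h}) divisible-mul public
    renaming ( _~_ to _≈ₚ_ ; difference to mod-p ; difference-in-ideal to mod-p-difference
             ; ≐⇒~ to ≐⇒≈ₚ ; ~-refl to ≈ₚ-refl ; ~-sym to ≈ₚ-sym ; ~-trans to ≈ₚ-trans
             ; ⊕~ to ⊕-≈ₚ ; ⊛~ to ⊛-≈ₚ ; neg~ to neg-≈ₚ
             ; difference-cancelʳ to ≈ₚ-cancelʳ ; difference-cancelˡ to ≈ₚ-cancelˡ ; difference-zero to difference≈ₚ[]
             ; ~-isEquivalence to ≈ₚ-isEquivalence ; ~-setoid to ≈ₚ-setoid )

  pointwise⇒≈ₚ : ∀ {g h} → (∀ n → p ∣ℤ coeff g n - coeff h n) → g ≈ₚ h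
  pointwise⇒≈ₚ {g} {h} d = mod-p λ n → subst (p ∣ℤ_) (sym (coeff-difference g h n)) (d n)

  ≈ₚ⇒pointwise : ∀ {g h} → g ≈ₚ h → ∀ n → p ∣ℤ coeff g n - coeff h n
  ≈ₚ⇒pointwise {g} {h} (mod-p d) n = subst (p ∣ℤ_) (coeff-difference g h n) (d n)

  divisible⇒≈ₚ[] : ∀ {g} → DivisibleByP g → g ≈ₚ []
  divisible⇒≈ₚ[] {g} d = mod-p (divisible-resp (≐-sym (⊕-identityʳ g)) d)

  divisible⇒multiple : ∀ g → DivisibleByP g → Σ Poly λ e → g ≐ scale (ℤ.+ p) e
  divisible⇒multiple []      d = [] , ≐-refl
  divisible⇒multiple (a ∷ g) d with d 0 | divisible⇒multiple g (λ n → d (suc n))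
  ... | divides q a≡qp | e , g≐pe =
    q ∷ e , coeffwise λ { zero → trans a≡qp (ℤP.*-comm q (ℤ.+ p)) ; (suc n) → ≐-at g≐pe n }

  ≈ₚ⇒CongP : ∀ {g h} → g ≈ₚ h → CongP p g h
  ≈ₚ⇒CongP {g} {h} (mod-p d) with divisible⇒multiple (g ⊕ neg h) d
  ... | e , g-h≐pe = e , ≐[]⇒IsZeroP _ (≐-trans (⊕-cong g-h≐pe ≐-refl)
                          (≐-trans (⊕-comm (scale (ℤ.+ p) e) (neg (scale (ℤ.+ p) e))) (neg-inverseˡ (scale (ℤ.+ p) e))))

  congruent-self : ∀ a → p ∣ℤ a - a
  congruent-self a = subst (p ∣ℤ_) (sym (ℤP.+-inverseʳ a)) (divisible-zero 0)

  ∷-≈ₚ : ∀ a {g h} → g ≈ₚ h → a ∷ g ≈ₚ a ∷ h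
  ∷-≈ₚ a g≈h = pointwise⇒≈ₚ λ { zero → congruent-self a ; (suc n) → ≈ₚ⇒pointwise g≈h n }

  -- g is congruent modulo p to a coefficient vector of length d + 1 whose
  -- top coefficient is a unit modulo p: g has degree d over GF(p).
  record Leading (g : Poly) : Set where
    constructor leading
    field
      degree       : ℕ
      coefficients : Vec ℤ (suc degree)
      top-unit     : ¬ (p ∣ℤ last coefficients)
      represents   : g ≈ₚ toList coefficients
      length-bound : suc degree ≤ length g

  zero-or-leading : ∀ g → DivisibleByP g ⊎ Leading g
  zero-or-leading []      = inj₁ divisible-zero
  zero-or-leading (a ∷ g) with zero-or-leading g
  ... | inj₂ (leading d v unit g≈v len) = inj₂ (leading (suc d) (a ∷ v) unit (∷-≈ₚ a g≈v) (s≤s len))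
  ... | inj₁ g≈0 with ℤ.+ p ℤD.∣? a
  ...   | yes p∣a = inj₁ λ { zero → p∣a ; (suc n) → g≈0 n }
  ...   | no  p∤a = inj₂ (leading 0 (a ∷ V.[]) p∤a a∷g≈a (s≤s z≤n))
    where
    a∷g≈a : a ∷ g ≈ₚ a ∷ []
    a∷g≈a = pointwise⇒≈ₚ λ { zero → congruent-self a
                           ; (suc n) → subst (p ∣ℤ_) (sym (ℤP.+-identityʳ (coeff g n))) (g≈0 n) }

  drop-top : ∀ n (v : Vec ℤ (suc n)) → p ∣ℤ last v → toList v ≈ₚ toList (init v)
  drop-top zero    (x ∷ V.[]) p∣x = pointwise⇒≈ₚ λ
    { zero → subst (p ∣ℤ_) (sym (ℤP.+-identityʳ x)) p∣x ; (suc k) → divisible-zero k }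
  drop-top (suc n) (x ∷ v)    p∣v = pointwise⇒≈ₚ λ
    { zero → congruent-self x ; (suc k) → ≈ₚ⇒pointwise (drop-top n v p∣v) k }

t : Poly
t = 0ℤ ∷ 1ℤ ∷ []

∷≐const⊕t⊛ : ∀ a g → a ∷ g ≐ (a ∷ []) ⊕ (t ⊛ g)
∷≐const⊕t⊛ a g = coeffwise λ n → sym (trans (coeff-⊕ (a ∷ []) (t ⊛ g) n) (shift n))
  where
  shift : ∀ n → coeff (a ∷ []) n + coeff (t ⊛ g) n ≡ coeff (a ∷ g) n
  shift zero = begin
    a + coeff (t ⊛ g) 0               ≡⟨ cong (a +_) (coeff-⊛ 0ℤ (1ℤ ∷ []) g 0) ⟩
    a + (0ℤ * coeff g 0 + 0ℤ)         ≡⟨ cancel a (coeff g 0) ⟩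
    a                                 ∎
    where
    open ≡-Reasoning
    cancel : ∀ a x → a + (0ℤ * x + 0ℤ) ≡ a
    cancel = solve-∀
  shift (suc n) = begin
    0ℤ + coeff (t ⊛ g) (suc n)                          ≡⟨ cong (0ℤ +_) (coeff-⊛ 0ℤ (1ℤ ∷ []) g (suc n)) ⟩
    0ℤ + (0ℤ * coeff g (suc n) + coeff (one ⊛ g) n)     ≡⟨ cong (λ x → 0ℤ + (0ℤ * coeff g (suc n) + x)) (≐-at (⊛-identityˡ g) n) ⟩
    0ℤ + (0ℤ * coeff g (suc n) + coeff g n)             ≡⟨ cancel (coeff g (suc n)) (coeff g n) ⟩
    coeff g n                                           ∎
    where
    open ≡-Reasoning
    cancel : ∀ x y → 0ℤ + (0ℤ * x + y) ≡ y
    cancel = solve-∀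

subtractMultiple : ∀ {k} → ℤ → Vec ℤ k → Vec ℤ k → Vec ℤ k
subtractMultiple c = V.zipWith (λ x y → x - c * y)

subtractMultiple-≐ : ∀ {k} c (s m : Vec ℤ k) → toList (subtractMultiple c s m) ≐ toList s ⊕ neg ((c ∷ []) ⊛ toList m)
subtractMultiple-≐ c s m = coeffwise λ n → sym (begin
  coeff (toList s ⊕ neg ((c ∷ []) ⊛ toList m)) n      ≡⟨ coeff-difference (toList s) ((c ∷ []) ⊛ toList m) n ⟩
  coeff (toList s) n - coeff ((c ∷ []) ⊛ toList m) n  ≡⟨ cong (λ x → coeff (toList s) n - x) (coeff-const⊛ c (toList m) n) ⟩
  coeff (toList s) n - c * coeff (toList m) n         ≡⟨ pointwise s m n ⟨
  coeff (toList (subtractMultiple c s m)) n           ∎)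
  where
  open ≡-Reasoning
  pointwise : ∀ {k} (s m : Vec ℤ k) n → coeff (toList (subtractMultiple c s m)) n ≡ coeff (toList s) n - c * coeff (toList m) n
  pointwise V.[] V.[] n = cong (λ x → 0ℤ - x) (sym (ℤP.*-zeroʳ c))
  pointwise (x ∷ s) (y ∷ m) zero    = refl
  pointwise (x ∷ s) (y ∷ m) (suc n) = pointwise s m n

last-subtractMultiple : ∀ k c (s m : Vec ℤ (suc k)) → last (subtractMultiple c s m) ≡ last s - c * last m
last-subtractMultiple zero    c (x ∷ V.[]) (y ∷ V.[]) = refl
last-subtractMultiple (suc k) c (x ∷ s)    (y ∷ m)    = last-subtractMultiple k c s m

module Division (p n : ℕ) (m : Vec ℤ (suc n)) (c' : ℤ) (inverse : p ∣ℤ last m * c' - 1ℤ) where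
  open ModP p

  M : Poly
  M = toList m

  record DivisionWithRemainder (g : Poly) : Set where
    constructor divided
    field
      quotient  : Poly
      remainder : Vec ℤ n
      identity  : g ≈ₚ (quotient ⊛ M) ⊕ toList remainder

  private
    byZero : ∀ M → [] ≐ ([] ⊛ M) ⊕ []
    byZero = solvePoly PolySolverRing
    rearrange : ∀ A X Q M R C → A ⊕ X ⊛ ((Q ⊛ M) ⊕ R) ≐ ((C ⊕ X ⊛ Q) ⊛ M) ⊕ ((A ⊕ X ⊛ R) ⊕ neg (C ⊛ M))
    rearrange = solvePoly PolySolverRing
    topVanishes : ∀ a c' m → a - a * c' * m ≡ (- a) * (m * c' - 1ℤ)
    topVanishes = solve-∀

  zeros≐[] : ∀ k → toList (V.replicate k 0ℤ) ≐ []
  zeros≐[] k = coeffwise (pointwise k)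
    where
    pointwise : ∀ k n → coeff (toList (V.replicate k 0ℤ)) n ≡ 0ℤ
    pointwise zero    n       = refl
    pointwise (suc k) zero    = refl
    pointwise (suc k) (suc n) = pointwise k n

  -- From g = q·m + r we get a + t·g = (c + t·q)·m + (s - c·m) with
  -- s = a + t·r and c = (top coefficient of s)·c', whose top coefficient
  -- vanishes modulo p.
  divideStep : ∀ a {g} → DivisionWithRemainder g → DivisionWithRemainder (a ∷ g)
  divideStep a {g} (divided q r g≈qm+r) = divided (c ∷ q) (init s') (begin
    a ∷ g                                                      ≈⟨ ≐⇒≈ₚ (∷≐const⊕t⊛ a g) ⟩
    (a ∷ []) ⊕ t ⊛ g                                           ≈⟨ ⊕-≈ₚ (≈ₚ-refl {a ∷ []}) (⊛-≈ₚ (≈ₚ-refl {t}) g≈qm+r) ⟩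
    (a ∷ []) ⊕ t ⊛ ((q ⊛ M) ⊕ toList r)                        ≈⟨ ≐⇒≈ₚ (rearrange (a ∷ []) t q M (toList r) (c ∷ [])) ⟩
    ((c ∷ []) ⊕ t ⊛ q) ⊛ M ⊕ (((a ∷ []) ⊕ t ⊛ toList r) ⊕ neg ((c ∷ []) ⊛ M))
                        ≈⟨ ≐⇒≈ₚ (⊕-cong (⊛-cong (≐-sym (∷≐const⊕t⊛ c q)) ≐-refl)
                                        (⊕-cong (≐-sym (∷≐const⊕t⊛ a (toList r))) ≐-refl)) ⟩
    (c ∷ q) ⊛ M ⊕ (toList s ⊕ neg ((c ∷ []) ⊛ M))              ≈⟨ ≐⇒≈ₚ (⊕-cong ≐-refl (≐-sym (subtractMultiple-≐ c s m))) ⟩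
    (c ∷ q) ⊛ M ⊕ toList s'                                    ≈⟨ ⊕-≈ₚ (≈ₚ-refl {(c ∷ q) ⊛ M}) (drop-top n s' top-divisible) ⟩
    (c ∷ q) ⊛ M ⊕ toList (init s')                             ∎)
    where
    open SetoidReasoning ≈ₚ-setoid
    s : Vec ℤ (suc n)
    s = a ∷ r
    c : ℤ
    c = last s * c'
    s' : Vec ℤ (suc n)
    s' = subtractMultiple c s m
    top-divisible : p ∣ℤ last s'
    top-divisible = subst (p ∣ℤ_) (sym (trans (last-subtractMultiple n c s m) (topVanishes (last s) c' (last m))))
                          (ℤD.∣n⇒∣m*n (- last s) inverse)

  divide : ∀ g → DivisionWithRemainder g
  divide []      = divided [] (V.replicate n 0ℤ) (≐⇒≈ₚ (≐-trans (byZero M) (⊕-cong ≐-refl (≐-sym (zeros≐[] n)))))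
  divide (a ∷ g) = divideStep a (divide g)

last-map : ∀ {A B : Set} (h : A → B) k (v : Vec A (suc k)) → last (V.map h v) ≡ h (last v)
last-map h zero    (x ∷ V.[]) = refl
last-map h (suc k) (x ∷ v)    = last-map h k v

powP-+ : ∀ g m n → powP g (m ℕ.+ n) ≐ powP g m ⊛ powP g n
powP-+ g zero    n = ≐-sym (⊛-identityˡ (powP g n))
powP-+ g (suc m) n = ≐-trans (⊛-congʳ g (powP-+ g m n)) (≐-sym (⊛-assoc g (powP g m) (powP g n)))

powP-* : ∀ g d j → powP g (j ℕ.* d) ≐ powP (powP g d) j
powP-* g d zero    = ≐-refl
powP-* g d (suc j) = ≐-trans (powP-+ g d (j ℕ.* d)) (⊛-congʳ (powP g d) (powP-* g d j))

powP-one : ∀ n → powP one n ≐ one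
powP-one zero    = ≐-refl
powP-one (suc n) = ≐-trans (⊛-congʳ one (powP-one n)) (⊛-identityˡ one)

powP-⊛ : ∀ g h n → powP (g ⊛ h) n ≐ powP g n ⊛ powP h n
powP-⊛ g h zero    = ≐-sym (⊛-identityˡ one)
powP-⊛ g h (suc n) = ≐-trans (⊛-congʳ (g ⊛ h) (powP-⊛ g h n)) (interchange g h (powP g n) (powP h n))
  where
  interchange : ∀ g h G H → (g ⊛ h) ⊛ (G ⊛ H) ≐ (g ⊛ G) ⊛ (h ⊛ H)
  interchange = solvePoly PolySolverRing

<∸1⇒suc< : ∀ {m n} → m < n ∸ 1 → suc m < n
<∸1⇒suc< {m} {suc n} m<n = s≤s m<n

<∧≢∸1⇒<∸1 : ∀ {a n} → a < n → a ≢ n ∸ 1 → a < n ∸ 1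
<∧≢∸1⇒<∸1 {a} {suc n} (s≤s a≤n) a≢n = ℕP.≤∧≢⇒< a≤n a≢n

zeroWhen : ∀ {A : Set} → Dec A → Poly → Poly
zeroWhen (yes _) g = []
zeroWhen (no  _) g = g

zeroWhen-yes : ∀ {A : Set} (d : Dec A) g → A → zeroWhen d g ≡ []
zeroWhen-yes (yes _) g _ = refl
zeroWhen-yes (no ¬a) g a = ⊥-elim (¬a a)

zeroWhen-no : ∀ {A : Set} (d : Dec A) g → ¬ A → zeroWhen d g ≡ g
zeroWhen-no (yes a) g ¬a = ⊥-elim (¬a a)
zeroWhen-no (no _)  g _  = refl

module QuotientField (p : ℕ) (p-prime : Prime p) (ν' : ℕ) (f : Vec (Fin p) (suc (suc ν')))
                     (f-top : toℕ (last f) ≢ 0) (f-irreducible : Irreducible p (suc ν') f) where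
  open ModP p

  instance
    p≢0 : ℕ.NonZero p
    p≢0 = prime⇒nonZero p-prime

  ν : ℕ
  ν = suc ν'

  fVec : Vec ℤ (suc ν)
  fVec = V.map ι f

  F : Poly
  F = toList fVec

  F≡lift : F ≡ lift f
  F≡lift = VP.toList-map ι f

  F-top-unit : ¬ (p ∣ℤ last fVec)
  F-top-unit p∣ = f-top (residue-zero (last f) (subst (p ∣ℤ_) (last-map ι ν f) p∣))

  MultipleOfF : Poly → Set
  MultipleOfF g = Σ Poly λ k → g ≈ₚ k ⊛ F

  private
    sumMultiple : ∀ k k' F → k ⊛ F ⊕ k' ⊛ F ≐ (k ⊕ k') ⊛ F
    sumMultiple = solvePoly PolySolverRing
    productMultiple : ∀ l k F → l ⊛ (k ⊛ F) ≐ (l ⊛ k) ⊛ F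
    productMultiple = solvePoly PolySolverRing

  multiple-resp : ∀ {g h} → g ≐ h → MultipleOfF g → MultipleOfF h
  multiple-resp e (k , g≈kF) = k , ≈ₚ-trans (≐⇒≈ₚ (≐-sym e)) g≈kF

  multiple-zero : MultipleOfF []
  multiple-zero = [] , ≈ₚ-refl

  multiple-add : ∀ {g h} → MultipleOfF g → MultipleOfF h → MultipleOfF (g ⊕ h)
  multiple-add (k , g≈kF) (k' , h≈k'F) = k ⊕ k' , ≈ₚ-trans (⊕-≈ₚ g≈kF h≈k'F) (≐⇒≈ₚ (sumMultiple k k' F))

  multiple-mul : ∀ l {g} → MultipleOfF g → MultipleOfF (l ⊛ g)
  multiple-mul l (k , g≈kF) = l ⊛ k , ≈ₚ-trans (⊛-≈ₚ (≈ₚ-refl {l}) g≈kF) (≐⇒≈ₚ (productMultiple l k F))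

  open IdealCongruence MultipleOfF multiple-resp multiple-zero (λ {g} {h} → multiple-add {g} {h}) multiple-mul public
    renaming ( _~_ to _≈F_ ; difference to mod-pf ; difference-in-ideal to mod-pf-difference
             ; ≐⇒~ to ≐⇒≈F ; ~-refl to ≈F-refl ; ~-sym to ≈F-sym ; ~-trans to ≈F-trans
             ; ⊕~ to ⊕-≈F ; ⊛~ to ⊛-≈F ; neg~ to neg-≈F
             ; difference-cancelʳ to ≈F-cancelʳ ; difference-cancelˡ to ≈F-cancelˡ ; difference-zero to difference≈F[]
             ; ~-isEquivalence to ≈F-isEquivalence ; ~-setoid to ≈F-setoid )

  private
    differenceMultiple : ∀ D K E → D ≐ ((D ⊕ neg K) ⊕ neg E) ⊕ (K ⊕ E)
    differenceMultiple = solvePoly PolySolverRing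
    emptyMultiple : ∀ D F → D ⊕ neg [] ≐ [] ⊛ F ⊕ D
    emptyMultiple = solvePoly PolySolverRing
    FMultiple : ∀ F → F ⊕ neg [] ≐ one ⊛ F
    FMultiple = solvePoly PolySolverRing

  ≈ₚ⇒≈F : ∀ {g h} → g ≈ₚ h → g ≈F h
  ≈ₚ⇒≈F {g} {h} g≈h = mod-pf ([] , ≈ₚ-trans g-h≈0 (≐⇒≈ₚ (≐-trans (≐-sym (⊕-identityʳ _)) (≐-sym (emptyMultiple [] F)))))
    where
    g-h≈0 : g ⊕ neg h ≈ₚ []
    g-h≈0 = divisible⇒≈ₚ[] (mod-p-difference g≈h)

  F≈F[] : F ≈F []
  F≈F[] = mod-pf (one , ≐⇒≈ₚ (FMultiple F))

  scale-p≈ₚ[] : ∀ e → scale (ℤ.+ p) e ≈ₚ []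
  scale-p≈ₚ[] e = divisible⇒≈ₚ[] λ n → subst (p ∣ℤ_) (sym (coeff-scale (ℤ.+ p) e n))
                                                  (divides (coeff e n) (ℤP.*-comm (ℤ.+ p) (coeff e n)))

  CongPF⇒≈F : ∀ {g h} → CongPF p (lift f) g h → g ≈F h
  CongPF⇒≈F {g} {h} (k , e , vanishes) = mod-pf (k , (begin
    g ⊕ neg h                                          ≈⟨ ≐⇒≈ₚ (differenceMultiple (g ⊕ neg h) (k ⊛ F) (scale (ℤ.+ p) e)) ⟩
    (((g ⊕ neg h) ⊕ neg (k ⊛ F)) ⊕ neg (scale (ℤ.+ p) e)) ⊕ (k ⊛ F ⊕ scale (ℤ.+ p) e)
                                                       ≈⟨ ≐⇒≈ₚ (⊕-cong (IsZeroP⇒≐[] vanishes′) ≐-refl) ⟩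
    [] ⊕ (k ⊛ F ⊕ scale (ℤ.+ p) e)                     ≈⟨ ⊕-≈ₚ (≈ₚ-refl {[]}) (⊕-≈ₚ (≈ₚ-refl {k ⊛ F}) (scale-p≈ₚ[] e)) ⟩
    [] ⊕ (k ⊛ F ⊕ [])                                  ≈⟨ ≐⇒≈ₚ (⊕-identityʳ (k ⊛ F)) ⟩
    k ⊛ F                                              ∎))
    where
    open SetoidReasoning ≈ₚ-setoid
    vanishes′ : IsZeroP (((g ⊕ neg h) ⊕ neg (k ⊛ F)) ⊕ neg (scale (ℤ.+ p) e))
    vanishes′ = subst (λ F′ → IsZeroP (((g ⊕ neg h) ⊕ neg (k ⊛ F′)) ⊕ neg (scale (ℤ.+ p) e))) (sym F≡lift) vanishes

  ≈ₚ[]⇒divisible : ∀ {g} → g ≈ₚ [] → DivisibleByP g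
  ≈ₚ[]⇒divisible {g} g≈0 = divisible-resp (⊕-identityʳ g) (mod-p-difference g≈0)

  BelowDegreeν : Poly → Set
  BelowDegreeν g = ∀ n → ν ≤ n → coeff g n ≡ 0ℤ

  unit-multiple-large : ∀ {g} d (u : Vec ℤ (suc d)) → ¬ (p ∣ℤ last u) → BelowDegreeν g → ¬ (g ≈ₚ toList u ⊛ F)
  unit-multiple-large {g} d u u-unit small g≈uF =
    [ u-unit , F-top-unit ]′ (prime∣product (last u) (last fVec) p-prime top-divisible)
    where
    n : ℕ
    n = d ℕ.+ ν
    top-difference : coeff g n - coeff (toList u ⊛ F) n ≡ - (last u * last fVec)
    top-difference = trans (cong₂ _-_ (small n (ℕP.m≤n+m ν d)) (coeff-⊛-top d ν u fVec)) (ℤP.+-identityˡ _)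
    top-divisible : p ∣ℤ last u * last fVec
    top-divisible = subst (p ∣ℤ_) (ℤP.neg-involutive _)
                      (ℤD.∣m⇒∣-m (subst (p ∣ℤ_) top-difference (≈ₚ⇒pointwise g≈uF n)))

  small-multiple : ∀ {g} k → BelowDegreeν g → g ≈ₚ k ⊛ F → DivisibleByP g
  small-multiple {g} k small g≈kF = [ k-zero , k-leading ]′ (zero-or-leading k)
    where
    k-zero : DivisibleByP k → DivisibleByP g
    k-zero k≈0 = ≈ₚ[]⇒divisible (≈ₚ-trans g≈kF (⊛-≈ₚ (divisible⇒≈ₚ[] {k} k≈0) (≈ₚ-refl {F})))
    k-leading : Leading k → DivisibleByP g
    k-leading (leading d u u-unit k≈u _) =
      ⊥-elim (unit-multiple-large d u u-unit small (≈ₚ-trans g≈kF (⊛-≈ₚ k≈u (≈ₚ-refl {F}))))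

  length-lift : ∀ {k} (v : Vec (Fin p) k) → length (lift v) ≡ k
  length-lift v = trans (LP.length-map _ (toList v)) (VP.length-toList v)

  toPoly-below : ∀ x → BelowDegreeν (toPoly p ν x)
  toPoly-below (z , π) n ν≤n = coeff-beyond (lift (z ∷ π)) n (subst (_≤ n) (sym (length-lift (z ∷ π))) ν≤n)

  lift-injective : ∀ {k} (v w : Vec (Fin p) k) → lift v ≈ₚ lift w → v ≡ w
  lift-injective V.[]    V.[]    _   = refl
  lift-injective (x ∷ v) (y ∷ w) v≈w = cong₂ _∷_ (residue-injective x y (≈ₚ⇒pointwise v≈w 0))
                                                 (lift-injective v w (pointwise⇒≈ₚ λ n → ≈ₚ⇒pointwise v≈w (suc n)))

  toPoly-injective : ∀ x x' → toPoly p ν x ≈F toPoly p ν x' → x ≡ x'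
  toPoly-injective (z , π) (z' , π') (mod-pf (k , difference≈kF)) =
    cong₂ _,_ (VP.∷-injectiveˡ same) (VP.∷-injectiveʳ same)
    where
    below : BelowDegreeν (lift (z ∷ π) ⊕ neg (lift (z' ∷ π')))
    below n ν≤n = trans (coeff-difference (lift (z ∷ π)) (lift (z' ∷ π')) n)
                        (cong₂ _-_ (toPoly-below (z , π) n ν≤n) (toPoly-below (z' , π') n ν≤n))
    same : z ∷ π ≡ z' ∷ π'
    same = lift-injective (z ∷ π) (z' ∷ π') (mod-p (small-multiple k below difference≈kF))

  one≉F[] : ¬ (one ≈F [])
  one≉F[] (mod-pf (k , one≈kF)) = ¬prime[1] (subst Prime (∣1⇒≡1 (ℤD.∣⇒∣ᵤ p∣1)) p-prime)
    where
    below : BelowDegreeν (one ⊕ neg [])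
    below (suc n) _ = refl
    p∣1 : p ∣ℤ 1ℤ
    p∣1 = small-multiple k below one≈kF 0

  -- Every polynomial is congruent modulo (p, f) to an element of GF(p^ν):
  -- divide by f and reduce the coefficients of the remainder modulo p.
  lift-residues : ∀ {k} (v : Vec ℤ k) → lift (V.map (residueOf p) v) ≈ₚ toList v
  lift-residues V.[]    = ≈ₚ-refl
  lift-residues (c ∷ v) = pointwise⇒≈ₚ λ { zero → residueOf-congruent p c ; (suc n) → ≈ₚ⇒pointwise (lift-residues v) n }

  F-inverse : Σ ℤ λ c' → p ∣ℤ last fVec * c' - 1ℤ
  F-inverse = intInverse (last fVec) p-prime F-top-unit

  reduce-remainder : ∀ (r : Vec ℤ ν) → Σ (GF p ν) λ x → toList r ≈ₚ toPoly p ν x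
  reduce-remainder (r₀ ∷ r) = (residueOf p r₀ , V.map (residueOf p) r) , ≈ₚ-sym (lift-residues (r₀ ∷ r))

  reduce : ∀ g → Σ (GF p ν) λ x → g ≈F toPoly p ν x
  reduce g = proj₁ (reduce-remainder remainder) , (begin
    g                          ≈⟨ ≈ₚ⇒≈F identity ⟩
    quotient ⊛ F ⊕ toList remainder   ≈⟨ ⊕-≈F (⊛-≈F (≈F-refl {quotient}) F≈F[]) (≈F-refl {toList remainder}) ⟩
    quotient ⊛ [] ⊕ toList remainder  ≈⟨ ≐⇒≈F (⊕-cong (⊛-zeroʳ quotient) ≐-refl) ⟩
    toList remainder                  ≈⟨ ≈ₚ⇒≈F (proj₂ (reduce-remainder remainder)) ⟩
    toPoly p ν (proj₁ (reduce-remainder remainder)) ∎)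
    where
    open SetoidReasoning ≈F-setoid
    open Division p ν fVec (proj₁ F-inverse) (proj₂ F-inverse)
    open DivisionWithRemainder (divide g)

  Invertible : Poly → Set
  Invertible g = Σ Poly λ w → w ⊛ g ≈F one

  constant-invertible : ∀ c → ¬ (p ∣ℤ c) → Invertible (c ∷ [])
  constant-invertible c p∤c = c' ∷ [] , ≈ₚ⇒≈F (pointwise⇒≈ₚ λ
    { zero    → subst (λ x → p ∣ℤ x - 1ℤ) (sym (trans (coeff-const⊛ c' (c ∷ []) 0) (ℤP.*-comm c' c))) p∣cc'-1
    ; (suc n) → subst (p ∣ℤ_) (sym (trans (cong (_- 0ℤ) (trans (coeff-const⊛ c' (c ∷ []) (suc n)) (ℤP.*-zeroʳ c'))) refl))
                      (divisible-zero n) })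
    where
    c' : ℤ
    c' = proj₁ (intInverse c p-prime p∤c)
    p∣cc'-1 : p ∣ℤ c * c' - 1ℤ
    p∣cc'-1 = proj₂ (intInverse c p-prime p∤c)

  F-full-degree : ∀ g → coeff g ν ≡ 0ℤ → ¬ (F ≈ₚ g)
  F-full-degree g g-vanishes F≈g = F-top-unit (subst (p ∣ℤ_) top (≈ₚ⇒pointwise F≈g ν))
    where
    top : coeff F ν - coeff g ν ≡ last fVec
    top = trans (cong₂ _-_ (coeff-last ν fVec) g-vanishes) (ℤP.+-identityʳ _)

  no-proper-factor : ∀ d (v : Vec ℤ (suc (suc d))) → ¬ (p ∣ℤ last v) → suc d < ν → ∀ q → ¬ (F ≈ₚ q ⊛ toList v)
  no-proper-factor d v v-unit d<ν q F≈qv = [ q-zero , q-leading ]′ (zero-or-leading q)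
    where
    q-zero : DivisibleByP q → ⊥
    q-zero q≈0 = F-full-degree [] refl (≈ₚ-trans F≈qv (⊛-≈ₚ (divisible⇒≈ₚ[] {q} q≈0) (≈ₚ-refl {toList v})))
    residue-unit : ∀ k (w : Vec ℤ (suc k)) → ¬ (p ∣ℤ last w) → toℕ (last (V.map (residueOf p) w)) ≢ 0
    residue-unit k w w-unit r≡0 = residueOf-nonzero p (last w) w-unit (trans (cong toℕ (sym (last-map (residueOf p) k w))) r≡0)
    -- a constant factor q leaves degree below ν; a factor of degree ≥ 1
    -- contradicts irreducibility
    q-leading : Leading q → ⊥
    q-leading (leading zero u _ q≈u _) =
      F-full-degree (toList u ⊛ toList v) (coeff-⊛-beyond (toList u) (toList v) ν short) (≈ₚ-trans F≈qv (⊛-≈ₚ q≈u (≈ₚ-refl {toList v})))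
      where
      short : length (toList u) ℕ.+ length (toList v) ≤ suc ν
      short = subst₂ (λ a b → a ℕ.+ b ≤ suc ν) (sym (VP.length-toList u)) (sym (VP.length-toList v)) (s≤s d<ν)
    q-leading (leading (suc e) u u-unit q≈u _) =
      f-irreducible e d (V.map (residueOf p) u) (V.map (residueOf p) v) (residue-unit (suc e) u u-unit) (residue-unit (suc d) v v-unit)
        (subst (λ F′ → CongP p F′ (lift (V.map (residueOf p) u) ⊛ lift (V.map (residueOf p) v))) F≡lift (≈ₚ⇒CongP (begin
          F                        ≈⟨ F≈qv ⟩
          q ⊛ toList v             ≈⟨ ⊛-≈ₚ q≈u (≈ₚ-refl {toList v}) ⟩
          toList u ⊛ toList v      ≈⟨ ⊛-≈ₚ (≈ₚ-sym (lift-residues u)) (≈ₚ-sym (lift-residues v)) ⟩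
          lift (V.map (residueOf p) u) ⊛ lift (V.map (residueOf p) v) ∎)))
      where open SetoidReasoning ≈ₚ-setoid

  private
    negatedProduct : ∀ w q V → neg (w ⊛ q) ⊛ V ≐ w ⊛ neg (q ⊛ V)
    negatedProduct = solvePoly PolySolverRing
    remainderDifference : ∀ Q R → R ≐ (Q ⊕ R) ⊕ neg Q
    remainderDifference = solvePoly PolySolverRing
    emptyDifference : ∀ Q → [] ⊕ neg Q ≐ neg Q
    emptyDifference = solvePoly PolySolverRing

  -- If f ≡ q·v + r and w inverts r, then -w·q inverts v, since
  -- r ≡ -q·v modulo (p, f).
  inverse-from-remainder : ∀ q V R → F ≈ₚ q ⊛ V ⊕ R → Invertible R → Invertible V
  inverse-from-remainder q V R F≈qV+R (w , wR≈1) = neg (w ⊛ q) , (begin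
    neg (w ⊛ q) ⊛ V      ≈⟨ ≐⇒≈F (negatedProduct w q V) ⟩
    w ⊛ neg (q ⊛ V)      ≈⟨ ⊛-≈F (≈F-refl {w}) (≈F-sym R≈-qV) ⟩
    w ⊛ R                ≈⟨ wR≈1 ⟩
    one                  ∎)
    where
    open SetoidReasoning ≈F-setoid
    R≈-qV : R ≈F neg (q ⊛ V)
    R≈-qV = begin
      R                       ≈⟨ ≐⇒≈F (remainderDifference (q ⊛ V) R) ⟩
      (q ⊛ V ⊕ R) ⊕ neg (q ⊛ V) ≈⟨ ⊕-≈F (≈ₚ⇒≈F (≈ₚ-sym F≈qV+R)) (≈F-refl {neg (q ⊛ V)}) ⟩
      F ⊕ neg (q ⊛ V)         ≈⟨ ⊕-≈F F≈F[] (≈F-refl {neg (q ⊛ V)}) ⟩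
      [] ⊕ neg (q ⊛ V)        ≈⟨ ≐⇒≈F (emptyDifference (q ⊛ V)) ⟩
      neg (q ⊛ V)             ∎

  invertible-resp : ∀ {g h} → g ≈F h → Invertible h → Invertible g
  invertible-resp {g} {h} g≈h (w , wh≈1) = w , ≈F-trans (⊛-≈F (≈F-refl {w}) g≈h) wh≈1

  InvertibleInDegree : ℕ → Set
  InvertibleInDegree d = ∀ (v : Vec ℤ (suc d)) → d < ν → ¬ (p ∣ℤ last v) → Invertible (toList v)

  -- One step of Euclid's algorithm: write f ≡ q·v + r with deg r < deg v.
  -- The remainder r is nonzero as f is irreducible, so it is invertible
  -- by induction, and then so is v.
  invert-by-remainder : ∀ d (v : Vec ℤ (suc (suc d))) → ¬ (p ∣ℤ last v) → suc d < ν →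
                        (∀ {d'} → d' < suc d → InvertibleInDegree d') →
                        ∀ q (r : Vec ℤ (suc d)) → F ≈ₚ q ⊛ toList v ⊕ toList r → Invertible (toList v)
  invert-by-remainder d v v-unit d<ν IH q r F≈qv+r = [ r-zero , r-leading ]′ (zero-or-leading (toList r))
    where
    r-zero : DivisibleByP (toList r) → Invertible (toList v)
    r-zero r≈0 = ⊥-elim (no-proper-factor d v v-unit d<ν q (≈ₚ-trans F≈qv+r
      (≈ₚ-trans (⊕-≈ₚ (≈ₚ-refl {q ⊛ toList v}) (divisible⇒≈ₚ[] {toList r} r≈0)) (≐⇒≈ₚ (⊕-identityʳ (q ⊛ toList v))))))
    r-leading : Leading (toList r) → Invertible (toList v)
    r-leading (leading d' v' v'-unit r≈v' bound) = inverse-from-remainder q (toList v) (toList r) F≈qv+r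
      (invertible-resp (≈ₚ⇒≈F r≈v') (IH d'<1+d v' (ℕP.<-trans d'<1+d d<ν) v'-unit))
      where
      d'<1+d : d' < suc d
      d'<1+d = subst (suc d' ≤_) (VP.length-toList r) bound

  euclid-step : ∀ d → (∀ {d'} → d' < d → InvertibleInDegree d') → InvertibleInDegree d
  euclid-step zero    _  (c ∷ V.[]) _ c-unit = constant-invertible c c-unit
  euclid-step (suc d) IH v d<ν v-unit = invert-by-remainder d v v-unit d<ν IH quotient remainder identity
    where
    open Division p (suc d) v (proj₁ (intInverse (last v) p-prime v-unit)) (proj₂ (intInverse (last v) p-prime v-unit))
    open DivisionWithRemainder (divide F)

  unit-invertible : ∀ d → InvertibleInDegree d
  unit-invertible = <-rec InvertibleInDegree euclid-step

  all-zero⇒≐[] : ∀ {k} (π : Vec (Fin p) k) → VAll.All (λ c → toℕ c ≡ 0) π → lift π ≐ []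
  all-zero⇒≐[] V.[]    VAll.[]         = ≐-refl
  all-zero⇒≐[] (c ∷ π) (c≡0 VAll.∷ π≡0) = coeffwise λ { zero → cong ℤ.+_ c≡0 ; (suc n) → ≐-at (all-zero⇒≐[] π π≡0) n }

  zero-element : ∀ x → IsZeroGF p ν x → toPoly p ν x ≐ []
  zero-element (z , π) (z≡0 , π≡0) = all-zero⇒≐[] (z ∷ π) (z≡0 VAll.∷ π≡0)

  divisible⇒all-zero : ∀ {k} (π : Vec (Fin p) k) → DivisibleByP (lift π) → VAll.All (λ c → toℕ c ≡ 0) π
  divisible⇒all-zero V.[]    _ = VAll.[]
  divisible⇒all-zero (c ∷ π) d = residue-zero c (d 0) VAll.∷ divisible⇒all-zero π (λ n → d (suc n))

  isZeroGF? : ∀ x → Dec (IsZeroGF p ν x)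
  isZeroGF? (z , π) = (toℕ z ℕ.≟ 0) ×-dec VAll.all? (λ c → toℕ c ℕ.≟ 0) π

  nonzero-invertible : ∀ x → ¬ IsZeroGF p ν x → Invertible (toPoly p ν x)
  nonzero-invertible (z , π) x≢0 = [ x-zero , x-leading ]′ (zero-or-leading (lift (z ∷ π)))
    where
    x-zero : DivisibleByP (lift (z ∷ π)) → Invertible (lift (z ∷ π))
    x-zero x≈0 = ⊥-elim (x≢0 (residue-zero z (x≈0 0) , divisible⇒all-zero π (λ n → x≈0 (suc n))))
    x-leading : Leading (lift (z ∷ π)) → Invertible (lift (z ∷ π))
    x-leading (leading d v v-unit x≈v bound) =
      invertible-resp (≈ₚ⇒≈F x≈v) (unit-invertible d v (subst (suc d ≤_) (length-lift (z ∷ π)) bound) v-unit)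

  invertible-nonzero : ∀ {g} → Invertible g → ¬ (g ≈F [])
  invertible-nonzero {g} (w , wg≈1) g≈0 =
    one≉F[] (≈F-trans (≈F-sym wg≈1) (≈F-trans (⊛-≈F (≈F-refl {w}) g≈0) (≐⇒≈F (⊛-zeroʳ w))))

  cancel : ∀ {c g h} → Invertible c → c ⊛ g ≈F c ⊛ h → g ≈F h
  cancel {c} {g} {h} (w , wc≈1) cg≈ch = begin
    g               ≈⟨ ≐⇒≈F (⊛-identityˡ g) ⟨
    one ⊛ g         ≈⟨ ⊛-≈F (≈F-sym wc≈1) (≈F-refl {g}) ⟩
    (w ⊛ c) ⊛ g     ≈⟨ ≐⇒≈F (⊛-assoc w c g) ⟩
    w ⊛ (c ⊛ g)     ≈⟨ ⊛-≈F (≈F-refl {w}) cg≈ch ⟩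
    w ⊛ (c ⊛ h)     ≈⟨ ≐⇒≈F (⊛-assoc w c h) ⟨
    (w ⊛ c) ⊛ h     ≈⟨ ⊛-≈F wc≈1 (≈F-refl {h}) ⟩
    one ⊛ h         ≈⟨ ≐⇒≈F (⊛-identityˡ h) ⟩
    h               ∎
    where open SetoidReasoning ≈F-setoid

  -- GF(p^ν) has no zero divisors: reduce a to an element x; if x ≠ 0 it
  -- is invertible and can be cancelled from a·b ≡ 0 = a·0.
  no-zero-divisors : ∀ a b → a ⊛ b ≈F [] → a ≈F [] ⊎ b ≈F []
  no-zero-divisors a b ab≈0 = zero-or-cancel (isZeroGF? x)
    where
    x : GF p ν
    x = proj₁ (reduce a)
    a≈x : a ≈F toPoly p ν x
    a≈x = proj₂ (reduce a)
    zero-or-cancel : Dec (IsZeroGF p ν x) → a ≈F [] ⊎ b ≈F []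
    zero-or-cancel (yes x≡0) = inj₁ (≈F-trans a≈x (≐⇒≈F (zero-element x x≡0)))
    zero-or-cancel (no  x≢0) = inj₂ (cancel (invertible-resp a≈x (nonzero-invertible x x≢0))
                                            (≈F-trans ab≈0 (≐⇒≈F (≐-sym (⊛-zeroʳ a)))))

  powP-≈F : ∀ n {g h} → g ≈F h → powP g n ≈F powP h n
  powP-≈F zero    g≈h = ≈F-refl
  powP-≈F (suc n) g≈h = ⊛-≈F g≈h (powP-≈F n g≈h)

  invertible-powP : ∀ {g} n → Invertible g → Invertible (powP g n)
  invertible-powP {g} n (w , wg≈1) = powP w n , (begin
    powP w n ⊛ powP g n   ≈⟨ ≐⇒≈F (≐-sym (powP-⊛ w g n)) ⟩
    powP (w ⊛ g) n        ≈⟨ powP-≈F n wg≈1 ⟩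
    powP one n            ≈⟨ ≐⇒≈F (powP-one n) ⟩
    one                   ∎)
    where open SetoidReasoning ≈F-setoid

  inverse-unique : ∀ {w g h} → w ⊛ g ≈F one → w ⊛ h ≈F one → g ≈F h
  inverse-unique {w} {g} {h} wg≈1 wh≈1 =
    cancel (g , ≈F-trans (≐⇒≈F (⊛-comm g w)) wg≈1) (≈F-trans wg≈1 (≈F-sym wh≈1))

  powP-periodic : ∀ {g} d .{{_ : ℕ.NonZero d}} k → powP g d ≈F one → powP g k ≈F powP g (k % d)
  powP-periodic {g} d k gᵈ≈1 = begin
    powP g k                                   ≡⟨ cong (powP g) (m≡m%n+[m/n]*n k d) ⟩
    powP g (k % d ℕ.+ (k / d) ℕ.* d)            ≈⟨ ≐⇒≈F (powP-+ g (k % d) ((k / d) ℕ.* d)) ⟩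
    powP g (k % d) ⊛ powP g ((k / d) ℕ.* d)     ≈⟨ ⊛-≈F (≈F-refl {powP g (k % d)}) (≐⇒≈F (powP-* g d (k / d))) ⟩
    powP g (k % d) ⊛ powP (powP g d) (k / d)    ≈⟨ ⊛-≈F (≈F-refl {powP g (k % d)}) (powP-≈F (k / d) gᵈ≈1) ⟩
    powP g (k % d) ⊛ powP one (k / d)           ≈⟨ ⊛-≈F (≈F-refl {powP g (k % d)}) (≐⇒≈F (powP-one (k / d))) ⟩
    powP g (k % d) ⊛ one                        ≈⟨ ≐⇒≈F (⊛-identityʳ (powP g (k % d))) ⟩
    powP g (k % d)                              ∎
    where open SetoidReasoning ≈F-setoid

-- GF(p^ν) with a generator y of its multiplicative group, and the
-- labelling L of the polynomials Σ_{i≥1} a_i t^i used to enumerate it.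
module Generated (p : ℕ) (p-prime : Prime p) (ν' : ℕ) (f : Vec (Fin p) (suc (suc ν')))
                 (f-top : toℕ (last f) ≢ 0) (f-irreducible : Irreducible p (suc ν') f)
                 (L : Labelling p (suc ν')) (y : GF p (suc ν')) (y-generates : Generator p (suc ν') f y) where
  open ModP p
  open QuotientField p p-prime ν' f f-top f-irreducible

  q-1 : ℕ
  q-1 = p ^ ν ∸ 1

  Y : Poly
  Y = toPoly p ν y

  Y-invertible : Invertible Y
  Y-invertible = nonzero-invertible y (proj₁ y-generates)

  W : Poly
  W = proj₁ Y-invertible

  WY≈1 : W ⊛ Y ≈F one
  WY≈1 = proj₂ Y-invertible

  logarithm : ∀ x → ¬ IsZeroGF p ν x → Σ ℕ λ k → toPoly p ν x ≈F powP Y k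
  logarithm x x≢0 = proj₁ y-power , CongPF⇒≈F {toPoly p ν x} {powP Y (proj₁ y-power)} (proj₂ y-power)
    where
    y-power : ∃ λ k → CongPF p (lift f) (toPoly p ν x) (powP Y k)
    y-power = proj₂ y-generates x x≢0

  split : Fin (p ^ ν) → Fin p × Fin (p ^ ν')
  split = Fin.remQuot {p} (p ^ ν')

  element : Fin (p ^ ν) → GF p ν
  element k = proj₁ (split k) , Bijection.to L (proj₂ (split k))

  element-injective : ∀ k k' → element k ≡ element k' → k ≡ k'
  element-injective k k' e = begin
    k                                  ≡⟨ FinP.combine-remQuot {p} (p ^ ν') k ⟨
    uncurry Fin.combine (split k)      ≡⟨ cong (uncurry Fin.combine) same-split ⟩
    uncurry Fin.combine (split k')     ≡⟨ FinP.combine-remQuot {p} (p ^ ν') k' ⟩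
    k'                                 ∎
    where
    open ≡-Reasoning
    same-split : split k ≡ split k'
    same-split = cong₂ _,_ (cong proj₁ e) (Bijection.injective L (cong proj₂ e))

  -- Zero, or the logarithm modulo d + 1: an invariant of elements that is
  -- injective when y^(d+1) = 1.
  classify : ∀ d x → Dec (IsZeroGF p ν x) → Fin (suc (suc d))
  classify d x (yes _)  = Fin.fromℕ (suc d)
  classify d x (no x≢0) = Fin.inject₁ (Fin.fromℕ< (m%n<n (proj₁ (logarithm x x≢0)) (suc d)))

  classify-injective : ∀ d → powP Y (suc d) ≈F one →
                       ∀ x x' dx dx' → classify d x dx ≡ classify d x' dx' → x ≡ x'
  classify-injective d period x x' (yes x≡0) (yes x'≡0) _ =
    toPoly-injective x x' (≐⇒≈F (≐-trans (zero-element x x≡0) (≐-sym (zero-element x' x'≡0))))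
  classify-injective d period x x' (yes _)   (no _)     e = ⊥-elim (FinP.fromℕ≢inject₁ e)
  classify-injective d period x x' (no _)    (yes _)    e = ⊥-elim (FinP.fromℕ≢inject₁ (sym e))
  classify-injective d period x x' (no x≢0)  (no x'≢0)  e = toPoly-injective x x' (begin
    toPoly p ν x                ≈⟨ proj₂ (logarithm x x≢0) ⟩
    powP Y k                    ≈⟨ powP-periodic (suc d) k period ⟩
    powP Y (k % suc d)          ≡⟨ cong (powP Y) same-residue ⟩
    powP Y (k' % suc d)         ≈⟨ powP-periodic (suc d) k' period ⟨
    powP Y k'                   ≈⟨ proj₂ (logarithm x' x'≢0) ⟨
    toPoly p ν x'               ∎)
    where
    open SetoidReasoning ≈F-setoid
    k k' : ℕ
    k  = proj₁ (logarithm x x≢0)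
    k' = proj₁ (logarithm x' x'≢0)
    same-residue : k % suc d ≡ k' % suc d
    same-residue = trans (sym (FinP.toℕ-fromℕ< (m%n<n k (suc d))))
                         (trans (cong toℕ (FinP.inject₁-injective e)) (FinP.toℕ-fromℕ< (m%n<n k' (suc d))))

  classify-index : ∀ d → Fin (p ^ ν) → Fin (suc (suc d))
  classify-index d k = classify d (element k) (isZeroGF? (element k))

  -- y has order q - 1: by pigeonhole, y^(d+1) = 1 forces q ≤ d + 2.
  order-bound : ∀ d → powP Y (suc d) ≈F one → ¬ (suc d < q-1)
  order-bound d period d<q-1 = no-collision (FinP.pigeonhole (<∸1⇒suc< d<q-1) (classify-index d))
    where
    no-collision : ∃₂ (λ i j → i Fin.< j × classify-index d i ≡ classify-index d j) → ⊥
    no-collision (i , j , i<j , same) = ℕP.<-irrefl (cong toℕ i≡j) i<j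
      where
      i≡j : i ≡ j
      i≡j = element-injective i j (classify-injective d period (element i) (element j)
                                     (isZeroGF? (element i)) (isZeroGF? (element j)) same)

  -- If y^a = y^b with a < b < q - 1, then y^(b-a) = 1 contradicts the order.
  powers-distinct-< : ∀ a b → a < b → b < q-1 → ¬ (powP Y a ≈F powP Y b)
  powers-distinct-< a b a<b b<q-1 yᵃ≈yᵇ = order-bound k period (ℕP.≤-<-trans k+1≤b b<q-1)
    where
    k : ℕ
    k = proj₁ (ℕP.m≤n⇒∃[o]m+o≡n a<b)
    a+[k+1]≡b : a ℕ.+ suc k ≡ b
    a+[k+1]≡b = trans (ℕP.+-suc a k) (proj₂ (ℕP.m≤n⇒∃[o]m+o≡n a<b))
    k+1≤b : suc k ≤ b
    k+1≤b = subst (suc k ≤_) a+[k+1]≡b (ℕP.m≤n+m (suc k) a)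
    period : powP Y (suc k) ≈F one
    period = cancel (invertible-powP a Y-invertible) (begin
      powP Y a ⊛ powP Y (suc k)   ≈⟨ ≐⇒≈F (powP-+ Y a (suc k)) ⟨
      powP Y (a ℕ.+ suc k)        ≡⟨ cong (powP Y) a+[k+1]≡b ⟩
      powP Y b                    ≈⟨ yᵃ≈yᵇ ⟨
      powP Y a                    ≈⟨ ≐⇒≈F (⊛-identityʳ (powP Y a)) ⟨
      powP Y a ⊛ one              ∎)
      where open SetoidReasoning ≈F-setoid

  powers-distinct : ∀ a b → a < q-1 → b < q-1 → powP Y a ≈F powP Y b → a ≡ b
  powers-distinct a b a<q-1 b<q-1 yᵃ≈yᵇ = by-comparison (ℕP.<-cmp a b)
    where
    by-comparison : Tri (a < b) (a ≡ b) (b < a) → a ≡ b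
    by-comparison (tri< a<b _ _) = ⊥-elim (powers-distinct-< a b a<b b<q-1 yᵃ≈yᵇ)
    by-comparison (tri≈ _ a≡b _) = a≡b
    by-comparison (tri> _ _ b<a) = ⊥-elim (powers-distinct-< b a b<a a<q-1 (≈F-sym yᵃ≈yᵇ))

  powerOrZero : Poly → Fin (p ^ ν) → Poly
  powerOrZero g i = zeroWhen (toℕ i ℕ.≟ q-1) (powP g (toℕ i))

  powerOrZero-injective : ∀ g → Invertible g → (∀ a b → a < q-1 → b < q-1 → powP g a ≈F powP g b → a ≡ b) →
                          ∀ i i' → powerOrZero g i ≈F powerOrZero g i' → i ≡ i'
  powerOrZero-injective g g-invertible distinct i i' = by-cases (toℕ i ℕ.≟ q-1) (toℕ i' ℕ.≟ q-1)
    where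
    by-cases : (di : Dec (toℕ i ≡ q-1)) (di' : Dec (toℕ i' ≡ q-1)) →
               zeroWhen di (powP g (toℕ i)) ≈F zeroWhen di' (powP g (toℕ i')) → i ≡ i'
    by-cases (yes i≡q-1) (yes i'≡q-1) _ = FinP.toℕ-injective (trans i≡q-1 (sym i'≡q-1))
    by-cases (yes _)     (no  _)      0≈gⁱ' = ⊥-elim (invertible-nonzero (invertible-powP (toℕ i') g-invertible) (≈F-sym 0≈gⁱ'))
    by-cases (no  _)     (yes _)      gⁱ≈0 = ⊥-elim (invertible-nonzero (invertible-powP (toℕ i) g-invertible) gⁱ≈0)
    by-cases (no  i≢q-1) (no  i'≢q-1) gⁱ≈gⁱ' = FinP.toℕ-injective
      (distinct (toℕ i) (toℕ i') (<∧≢∸1⇒<∸1 (FinP.toℕ<n i) i≢q-1) (<∧≢∸1⇒<∸1 (FinP.toℕ<n i') i'≢q-1) gⁱ≈gⁱ')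

  -- The powers of W = y⁻¹ are distinct as well, being inverse to those of y.
  W-powers-distinct : ∀ a b → a < q-1 → b < q-1 → powP W a ≈F powP W b → a ≡ b
  W-powers-distinct a b a<q-1 b<q-1 wᵃ≈wᵇ = powers-distinct a b a<q-1 b<q-1
    (inverse-unique {powP W a} {powP Y a} {powP Y b} (proj₂ (invertible-powP a Y-invertible))
                    (≈F-trans (⊛-≈F wᵃ≈wᵇ (≈F-refl {powP Y b})) (proj₂ (invertible-powP b Y-invertible))))

  W-invertible : Invertible W
  W-invertible = Y , ≈F-trans (≐⇒≈F (⊛-comm Y W)) WY≈1

  private
    regroup : ∀ X A B → X ⊛ (B ⊛ A) ≐ (X ⊛ A) ⊛ B
    regroup = solvePoly PolySolverRing

  gamma-factors : ∀ i j x → Gamma p ν f y i j x → toPoly p ν x ≈F powerOrZero Y i ⊛ powerOrZero W j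
  gamma-factors i j x (lastRow i≡q-1 x≡0) =
    subst (λ E → toPoly p ν x ≈F E ⊛ powerOrZero W j) (sym (zeroWhen-yes (toℕ i ℕ.≟ q-1) _ i≡q-1))
          (≐⇒≈F (zero-element x x≡0))
  gamma-factors i j x (lastCol j≡q-1 x≡0) =
    subst (λ G → toPoly p ν x ≈F powerOrZero Y i ⊛ G) (sym (zeroWhen-yes (toℕ j ℕ.≟ q-1) _ j≡q-1))
          (≐⇒≈F (≐-trans (zero-element x x≡0) (≐-sym (⊛-zeroʳ (powerOrZero Y i)))))
  gamma-factors i j x (inner i≢q-1 j≢q-1 xyʲ≡yⁱ) =
    subst₂ (λ E G → X ≈F E ⊛ G) (sym (zeroWhen-no (toℕ i ℕ.≟ q-1) _ i≢q-1)) (sym (zeroWhen-no (toℕ j ℕ.≟ q-1) _ j≢q-1)) (begin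
      X                                     ≈⟨ ≐⇒≈F (⊛-identityʳ X) ⟨
      X ⊛ one                               ≈⟨ ⊛-≈F (≈F-refl {X}) (≈F-sym (proj₂ (invertible-powP (toℕ j) Y-invertible))) ⟩
      X ⊛ (powP W (toℕ j) ⊛ powP Y (toℕ j)) ≈⟨ ≐⇒≈F (regroup X (powP Y (toℕ j)) (powP W (toℕ j))) ⟩
      (X ⊛ powP Y (toℕ j)) ⊛ powP W (toℕ j) ≈⟨ ⊛-≈F (CongPF⇒≈F {X ⊛ powP Y (toℕ j)} {powP Y (toℕ i)} xyʲ≡yⁱ) (≈F-refl {powP W (toℕ j)}) ⟩
      powP Y (toℕ i) ⊛ powP W (toℕ j)       ∎)
    where
    open SetoidReasoning ≈F-setoid
    X : Poly
    X = toPoly p ν x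

  -- A 1 of the blow-up in block (i, j), at the row and column whose
  -- positions inside their blocks are described by c and d: γ_ij = x with
  -- c - d ≡ x.
  record Entry (i j : Fin (p ^ ν)) (c d : Poly) : Set where
    constructor entry
    field
      value       : GF p ν
      is-gamma    : Gamma p ν f y i j value
      difference≈ : c ⊕ neg d ≈ₚ toPoly p ν value

  private
    expandProduct : ∀ E E' G G' → (E ⊕ neg E') ⊛ (G ⊕ neg G') ≐ (((E ⊛ G) ⊕ neg (E ⊛ G')) ⊕ neg (E' ⊛ G)) ⊕ (E' ⊛ G')
    expandProduct = solvePoly PolySolverRing
    alternatingSum : ∀ c₁ c₂ d₁ d₂ → (((c₁ ⊕ neg d₁) ⊕ neg (c₁ ⊕ neg d₂)) ⊕ neg (c₂ ⊕ neg d₁)) ⊕ (c₂ ⊕ neg d₂) ≐ []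
    alternatingSum = solvePoly PolySolverRing

  -- If the four entries (i,c₁ | j,d₁), (i,c₁ | j',d₂), (i',c₂ | j,d₁),
  -- (i',c₂ | j',d₂) are 1, then
  --   (y^i - y^i')(y^-j - y^-j') = γ_ij - γ_ij' - γ_i'j + γ_i'j' ≡ 0.
  rectangle-product : ∀ {i i' j j' c₁ c₂ d₁ d₂} →
    Entry i j c₁ d₁ → Entry i j' c₁ d₂ → Entry i' j c₂ d₁ → Entry i' j' c₂ d₂ →
    (powerOrZero Y i ⊕ neg (powerOrZero Y i')) ⊛ (powerOrZero W j ⊕ neg (powerOrZero W j')) ≈F []
  rectangle-product {i} {i'} {j} {j'} {c₁} {c₂} {d₁} {d₂}
                    (entry x₁₁ γ₁₁ e₁₁) (entry x₁₂ γ₁₂ e₁₂) (entry x₂₁ γ₂₁ e₂₁) (entry x₂₂ γ₂₂ e₂₂) = begin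
    (E ⊕ neg E') ⊛ (G ⊕ neg G')
      ≈⟨ ≐⇒≈F (expandProduct E E' G G') ⟩
    (((E ⊛ G) ⊕ neg (E ⊛ G')) ⊕ neg (E' ⊛ G)) ⊕ (E' ⊛ G')
      ≈⟨ ⊕-≈F (⊕-≈F (⊕-≈F (≈F-sym (gamma-factors i j x₁₁ γ₁₁)) (neg-≈F (≈F-sym (gamma-factors i j' x₁₂ γ₁₂))))
                     (neg-≈F (≈F-sym (gamma-factors i' j x₂₁ γ₂₁)))) (≈F-sym (gamma-factors i' j' x₂₂ γ₂₂)) ⟩
    ((toPoly p ν x₁₁ ⊕ neg (toPoly p ν x₁₂)) ⊕ neg (toPoly p ν x₂₁)) ⊕ toPoly p ν x₂₂
      ≈⟨ ≈ₚ⇒≈F (⊕-≈ₚ (⊕-≈ₚ (⊕-≈ₚ (≈ₚ-sym e₁₁) (neg-≈ₚ (≈ₚ-sym e₁₂))) (neg-≈ₚ (≈ₚ-sym e₂₁))) (≈ₚ-sym e₂₂)) ⟩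
    (((c₁ ⊕ neg d₁) ⊕ neg (c₁ ⊕ neg d₂)) ⊕ neg (c₂ ⊕ neg d₁)) ⊕ (c₂ ⊕ neg d₂)
      ≈⟨ ≐⇒≈F (alternatingSum c₁ c₂ d₁ d₂) ⟩
    [] ∎
    where
    open SetoidReasoning ≈F-setoid
    E E' G G' : Poly
    E  = powerOrZero Y i
    E' = powerOrZero Y i'
    G  = powerOrZero W j
    G' = powerOrZero W j'

  -- Rows whose block factors y^i, y^i' agree: then γ_ij = γ_i'j, so i = i'
  -- and the rows' positions within the blocks agree modulo p.
  same-row : ∀ {i i' j c₁ c₂ d} → Entry i j c₁ d → Entry i' j c₂ d →
             powerOrZero Y i ≈F powerOrZero Y i' → i ≡ i' × c₁ ≈ₚ c₂
  same-row {i} {i'} {j} {c₁} {c₂} {d} (entry x γ e) (entry x' γ' e') yⁱ≈yⁱ' =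
    powerOrZero-injective Y Y-invertible powers-distinct i i' yⁱ≈yⁱ' ,
    ≈ₚ-cancelʳ {c₁} {c₂} {d} (≈ₚ-trans (subst (λ z → c₁ ⊕ neg d ≈ₚ toPoly p ν z) x≡x' e) (≈ₚ-sym e'))
    where
    x≡x' : x ≡ x'
    x≡x' = toPoly-injective x x' (≈F-trans (gamma-factors i j x γ)
             (≈F-trans (⊛-≈F yⁱ≈yⁱ' (≈F-refl {powerOrZero W j})) (≈F-sym (gamma-factors i' j x' γ'))))

  same-column : ∀ {i j j' c d₁ d₂} → Entry i j c d₁ → Entry i j' c d₂ →
                powerOrZero W j ≈F powerOrZero W j' → j ≡ j' × d₁ ≈ₚ d₂
  same-column {i} {j} {j'} {c} {d₁} {d₂} (entry x γ e) (entry x' γ' e') wʲ≈wʲ' =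
    powerOrZero-injective W W-invertible W-powers-distinct j j' wʲ≈wʲ' ,
    ≈ₚ-cancelˡ {c} {d₁} {d₂} (≈ₚ-trans (subst (λ z → c ⊕ neg d₁ ≈ₚ toPoly p ν z) x≡x' e) (≈ₚ-sym e'))
    where
    x≡x' : x ≡ x'
    x≡x' = toPoly-injective x x' (≈F-trans (gamma-factors i j x γ)
             (≈F-trans (⊛-≈F (≈F-refl {powerOrZero Y i}) wʲ≈wʲ') (≈F-sym (gamma-factors i j' x' γ'))))

  -- The heart of the proof: in the field GF(p^ν) one of the two factors of
  -- the rectangle product vanishes, so the rows or the columns coincide.
  rectangle : ∀ {i i' j j' c₁ c₂ d₁ d₂} → Entry i j c₁ d₁ → Entry i j' c₁ d₂ → Entry i' j c₂ d₁ → Entry i' j' c₂ d₂ →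
              (i ≡ i' × c₁ ≈ₚ c₂) ⊎ (j ≡ j' × d₁ ≈ₚ d₂)
  rectangle {i} {i'} {j} {j'} e₁₁ e₁₂ e₂₁ e₂₂ =
    Sum.map (λ yⁱ-yⁱ'≈0 → same-row e₁₁ e₂₁ (difference≈F[] {powerOrZero Y i} {powerOrZero Y i'} yⁱ-yⁱ'≈0))
            (λ wʲ-wʲ'≈0 → same-column e₁₁ e₁₂ (difference≈F[] {powerOrZero W j} {powerOrZero W j'} wʲ-wʲ'≈0))
            (no-zero-divisors _ _ (rectangle-product e₁₁ e₁₂ e₂₁ e₂₂))

  -- The position (r, a) inside a block, read as the element π_r - a.
  cell : Fin (p ^ ν') → Fin p → Poly
  cell r a = (- ι a) ∷ lift (label p ν L r)

  private
    negDifference : ∀ u v → (- u) - (- v) ≡ - (u - v)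
    negDifference = solve-∀

  cell-injective : ∀ r a r' a' → cell r a ≈ₚ cell r' a' → (r , a) ≡ (r' , a')
  cell-injective r a r' a' e = cong₂ _,_ r≡r' a≡a'
    where
    a≡a' : a ≡ a'
    a≡a' = residue-injective a a' (subst (p ∣ℤ_) (ℤP.neg-involutive (ι a - ι a'))
             (ℤD.∣m⇒∣-m (subst (p ∣ℤ_) (negDifference (ι a) (ι a')) (≈ₚ⇒pointwise e 0))))
    r≡r' : r ≡ r'
    r≡r' = Bijection.injective L (lift-injective (label p ν L r) (label p ν L r')
             (pointwise⇒≈ₚ λ n → ≈ₚ⇒pointwise e (suc n)))

  lookup-congruence : ∀ {k} (u v w : Vec (Fin p) k) → (∀ l → DiffMod p (lookup u l) (lookup v l) (lookup w l)) →
                      ∀ n → p ∣ℤ (coeff (lift u) n - coeff (lift v) n) - coeff (lift w) n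
  lookup-congruence V.[]    V.[]    V.[]    _ n       = divisible-zero n
  lookup-congruence (a ∷ u) (b ∷ v) (c ∷ w) h zero    = ℤD.∣ᵤ⇒∣ (h Fin.zero)
  lookup-congruence (a ∷ u) (b ∷ v) (c ∷ w) h (suc n) = lookup-congruence u v w (λ l → h (Fin.suc l)) n

  private
    negatedSum : ∀ a b z → ((- a) - (- b)) - z ≡ (b - a) - z
    negatedSum = solve-∀

  -- A 1 of the blow-up at ((i,r),a), ((j,s),b): γ_ij = π + z with
  -- π = π_r - π_s and z = b - a, i.e. γ_ij ≡ (π_r - a) - (π_s - b).
  blowup-entry : ∀ i r a j s b → BlowUp (CScheme p ν f L y) ((i , r) , a) ((j , s) , b) → Entry i j (cell r a) (cell s b)
  blowup-entry i r a j s b (z , b-a≡z , (z , π) , γ , πᵣ-πₛ≡π , refl) = entry (z , π) γ (pointwise⇒≈ₚ λ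
    { zero    → subst (λ u → p ∣ℤ u - ι z) (sym (coeff-difference (cell r a) (cell s b) 0))
                      (subst (p ∣ℤ_) (sym (negatedSum (ι a) (ι b) (ι z))) (ℤD.∣ᵤ⇒∣ b-a≡z))
    ; (suc n) → subst (λ u → p ∣ℤ u - coeff (lift π) n) (sym (coeff-difference (cell r a) (cell s b) (suc n)))
                      (lookup-congruence (label p ν L r) (label p ν L s) π πᵣ-πₛ≡π n) })

  j2-free : J2Free (CScheme p ν f L y)
  j2-free ((i , r) , a) ((i' , r') , a') ((j , s) , b) ((j' , s') , b') R≢R' C≢C' (b₁₁ , b₁₂ , b₂₁ , b₂₂) =
    [ (λ (i≡i' , cells≈) → R≢R' (cong₂ (λ k ra → (k , proj₁ ra) , proj₂ ra) i≡i' (cell-injective r a r' a' cells≈)))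
    , (λ (j≡j' , cells≈) → C≢C' (cong₂ (λ k sb → (k , proj₁ sb) , proj₂ sb) j≡j' (cell-injective s b s' b' cells≈)))
    ]′ (rectangle (blowup-entry i r a j s b b₁₁) (blowup-entry i r a j' s' b' b₁₂)
                  (blowup-entry i' r' a' j s b b₂₁) (blowup-entry i' r' a' j' s' b' b₂₂))

mainTheorem8 : (p ν : ℕ) → Prime p → 1 ≤ ν →
    (f : Vec (Fin p) (suc ν)) → toℕ (last f) ≢ 0 → Irreducible p ν f →
    (L : Labelling p ν) → FirstIsZero p ν L →
    (y : GF p ν) → Generator p ν f y →
    J2Free (CScheme p ν f L y)
mainTheorem8 p (suc ν') p-prime (s≤s z≤n) f f-top f-irreducible L _ y y-generates =
  Generated.j2-free p p-prime ν' f f-top f-irreducible L y y-generates
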